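{- For any integers $k>m_1>m_2>0$, $$F_{[k,m_1,m_2]}(x)=\frac{U_{\alpha+\beta}(z)U_{\alpha+\gamma-1}(z)U_{\beta+\gamma}(z)+U_{\beta-1}(z)U_\beta(z)}{\sqrt{x}\,U_{\alpha+\beta}(z)U_{\alpha+\gamma}(z)U_{\beta+\gamma}(z)},$$ where $\alpha=k-m_1$, $\beta=m_1-m_2$, $\gamma=m_2$, and $z=1/(2\sqrt{x})$.
   Context: A permutation $\alpha\in S_n$ contains a pattern $\tau\in S_k$ if there are indices $1\le i_1<\dots<i_k\le n$ with $(\alpha_{i_1},\dots,\alpha_{i_k})$ order-isomorphic to $\tau$; otherwise it avoids $\tau$. For a pattern $\tau$, $f_\tau(n)$ is the number of permutations in $S_n$ avoiding both $132$ and $\tau$ ($S_0$ consists of the empty permutation), and $F_\tau(x)=\sum_{n\ge0}f_\tau(n)x^n$. For $k>m_1>m_2>0$, $[k,m_1,m_2]$ denotes the permutation $(m_1+1,\dots,k,\ m_2+1,\dots,m_1,\ 1,\dots,m_2)\in S_k$. $U_p$ is the Chebyshev polynomial of the second kind, $U_p(\cos\theta)=\sin((p+1)\theta)/\sin\theta$, with $U_{ -1}=0$. -}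

module Defs where

open import Data.Bool using (Bool; true; false; _∧_; not)
open import Data.Nat using (ℕ; zero; suc; _+_; _∸_; _<ᵇ_)
open import Data.Integer using (ℤ; +_; -_) renaming (_+_ to _+ℤ_; _*_ to _*ℤ_)
open import Data.List using (List; []; _∷_; map; _++_; concatMap; length; filter; upTo; zip)
open import Data.Bool.ListAction using (any; all)
open import Data.Product using (_,_; _×_; proj₁; proj₂)
open import Relation.Nullary.Decidable using (T?)
open import Data.Bool.Properties using () renaming (_≟_ to _≟ᵇ_)
open import Data.Bool using (T)

-- Permutations, represented as lists of values (a rearrangement of 0..n-1)

insertions : ℕ → List ℕ → List (List ℕ)
insertions x [] = (x ∷ []) ∷ []
insertions x (y ∷ ys) = (x ∷ y ∷ ys) ∷ map (y ∷_) (insertions x ys)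

perms : List ℕ → List (List ℕ)
perms [] = [] ∷ []
perms (x ∷ xs) = concatMap (insertions x) (perms xs)

Sym : ℕ → List (List ℕ)
Sym n = perms (upTo n)

subseqs : List ℕ → List (List ℕ)
subseqs [] = [] ∷ []
subseqs (x ∷ xs) = map (x ∷_) (subseqs xs) ++ subseqs xs

_==ᵇ_ : Bool → Bool → Bool
true ==ᵇ b = b
false ==ᵇ b = not b

orderIso : List ℕ → List ℕ → Bool
orderIso [] [] = true
orderIso (a ∷ as) (b ∷ bs) =
  all (λ p → ((a <ᵇ proj₁ p) ==ᵇ (b <ᵇ proj₂ p)) ∧ ((proj₁ p <ᵇ a) ==ᵇ (proj₂ p <ᵇ b))) (zip as bs)
  ∧ orderIso as bs
orderIso [] (_ ∷ _) = false
orderIso (_ ∷ _) [] = false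

contains : List ℕ → List ℕ → Bool
contains α τ = any (orderIso τ) (subseqs α)

p132 : List ℕ
p132 = 1 ∷ 3 ∷ 2 ∷ []

avoids132and : List ℕ → List ℕ → Bool
avoids132and τ α = not (contains α p132) ∧ not (contains α τ)

f : List ℕ → ℕ → ℕ
f τ n = length (filter (λ α → T? (avoids132and τ α)) (Sym n))

range : ℕ → ℕ → List ℕ
range a b = map (λ i → suc (a + i)) (upTo (b ∸ a))

-- [k,m1,m2] = (m1+1,...,k, m2+1,...,m1, 1,...,m2)
pat : ℕ → ℕ → ℕ → List ℕ
pat k m₁ m₂ = range m₁ k ++ range m₂ m₁ ++ range 0 m₂

-- Polynomials in x with integer coefficients (coefficient lists, lowest first)

Poly : Set
Poly = List ℤ

_⊕_ : Poly → Poly → Poly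
[] ⊕ q = q
(a ∷ p) ⊕ [] = a ∷ p
(a ∷ p) ⊕ (b ∷ q) = (a +ℤ b) ∷ (p ⊕ q)

scale : ℤ → Poly → Poly
scale c = map (c *ℤ_)

_⊗_ : Poly → Poly → Poly
[] ⊗ q = []
(a ∷ p) ⊗ q = scale a q ⊕ (+ 0 ∷ (p ⊗ q))

shift : ℕ → Poly → Poly
shift zero p = p
shift (suc k) p = + 0 ∷ shift k p

coeff : Poly → ℕ → ℤ
coeff [] _ = + 0
coeff (a ∷ p) zero = a
coeff (a ∷ p) (suc n) = coeff p n

-- Rescaled Chebyshev polynomials: R p (x) = x^{p/2} U_p(1/(2√x)).
-- They satisfy R_{-1} = 0, R_0 = 1, R_{p+1} = R_p - x R_{p-1}
-- (from U_{p+1}(z) = 2z U_p(z) - U_{p-1}(z)).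
Rpair : ℕ → Poly × Poly
Rpair zero = [] , (+ 1 ∷ [])
Rpair (suc p) with Rpair p
... | (prev , cur) = cur , (cur ⊕ shift 1 (scale (- + 1) prev))

R : ℕ → Poly
R p = proj₂ (Rpair p)

conv : (ℕ → ℤ) → (ℕ → ℤ) → ℕ → ℤ
conv a b n = go (suc n)
  where
  go : ℕ → ℤ
  go zero = + 0
  go (suc i) = go i +ℤ (a i *ℤ b (n ∸ i))

{-# OPTIONS --safe #-}
-- A 132-avoiding permutation of 0, …, n is glued around its maximum n from two smaller 132-avoiders,
-- the left one lying entirely above the right one. An occurrence of a layered pattern (increasing runs,
-- each above all later ones) in such a permutation lies inside one of the two parts, splits at a
-- boundary between runs, or ends its first run at n. Hence the generating functions F, G and H of the
-- 132-avoiders avoiding a one-, two- or three-run pattern satisfy equations Y = 1 + x (A Y + C Y + K)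
-- with A and C among the F j. With F j = cheb j / cheb (j + 1), where cheb (p + 2) = cheb (p + 1) - x cheb p,
-- these become polynomial identities, which follow from the addition formula and the Casoratian of the
-- recurrence; everything is stated without division in ℤ[[x]].

module Submission where

open import Defs
open import Level using (0ℓ)
open import Function using (_∘_; Equivalence; mk⇔; case_of_)
open import Data.Bool using (Bool; true; false; _∧_; _∨_; not; T; f≤t; b≤b) renaming (_≤_ to _≤ᵇ_)
open import Data.Bool.Properties using (T-∧; T-∨; T-≡; ∧-zeroʳ)
open import Data.Bool.ListAction using (all)
open import Data.Empty using (⊥; ⊥-elim)
open import Data.Product using (∃; ∃₂; _×_; _,_; proj₁; proj₂)
open import Data.Sum using (_⊎_; inj₁; inj₂; [_,_])
open import Data.Maybe using (Maybe; just; nothing)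
open import Data.Nat as ℕ using (ℕ; zero; suc; _+_; _∸_; _<_; _≤_; _<ᵇ_; z≤n; s≤s)
import Data.Nat.Properties as ℕ
open import Data.Nat.ListAction using (sum)
open import Data.Nat.ListAction.Properties using (sum-++)
open import Data.Integer using (ℤ; 0ℤ; 1ℤ; -1ℤ; -_) renaming (_+_ to _+ℤ_; _*_ to _*ℤ_)
import Data.Integer as ℤ using (+_; -[1+_]; +-*-rawRing; _≟_)
import Data.Integer.Properties as ℤ
open import Data.Integer.Tactic.RingSolver using (solve-∀)
open import Data.List using (List; []; _∷_; _++_; map; concatMap; length; filter; zip; take; drop; upTo)
import Data.List.Properties as List
open import Data.List.Membership.Propositional using (_∈_; _∉_; find; lose)
open import Data.List.Membership.Propositional.Properties
  using (∈-++⁺ˡ; ∈-++⁺ʳ; ∈-++⁻; ∈-map⁺; ∈-map⁻; ∈-concatMap⁺; ∈-concatMap⁻; ∈-upTo⁺; ∈-upTo⁻; ∈-∃++;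
         ∈-filter⁺; ∈-filter⁻)
open import Data.List.Membership.Propositional.Properties.WithK using (unique∧set⇒bag)
open import Data.List.Relation.Unary.Any using (here; there)
open import Data.List.Relation.Unary.Any.Properties using (any⁺; any⁻)
open import Data.List.Relation.Unary.All as All using (All; []; _∷_)
open import Data.List.Relation.Unary.All.Properties using (all⁺; all⁻)
open import Data.List.Relation.Unary.Unique.Propositional using (Unique; []; _∷_)
import Data.List.Relation.Unary.Unique.Propositional.Properties as Unique
open import Data.List.Relation.Binary.Sublist.Propositional using (_⊆_; []; _∷_; _∷ʳ_; ⊆-refl; ⊆-trans; minimum; lookup)
open import Data.List.Relation.Binary.Sublist.Propositional.Properties
  using (take-⊆; drop-⊆) renaming (++⁺ to ⊆-++⁺; map⁺ to ⊆-map⁺)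
open import Data.List.Relation.Binary.Permutation.Propositional
  using (_↭_; ↭-sym; ↭⇒↭ₛ; module PermutationReasoning)
  renaming (refl to ↭-refl; prep to ↭-prep; swap to ↭-swap; trans to ↭-trans)
open import Data.List.Relation.Binary.Permutation.Propositional.Properties
  using (∈-resp-↭; ↭-empty-inv; drop-mid; ++⁺; ++⁺ˡ; map⁺; ++-comm; ∷↭∷ʳ; ↭-length; ↭-map-inv)
  renaming (shift to ↭-shift)
import Data.List.Relation.Binary.Permutation.Setoid.Properties as PermutationSetoid
open import Data.List.Relation.Binary.BagAndSetEquality using (∼bag⇒↭)
open import Relation.Nullary using (¬_; yes; no)
open import Relation.Nullary.Decidable using (T?)
open import Relation.Binary.Definitions using (tri<; tri≈; tri>)
open import Relation.Binary.PropositionalEquality using (_≡_; refl; sym; trans; cong; cong₂; subst; subst₂; setoid; module ≡-Reasoning)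
import Relation.Binary.Reasoning.Setoid
open import Algebra.Bundles using (CommutativeRing)
open import Algebra.Structures using (IsAbelianGroup)
open import Algebra.Solver.Ring.AlmostCommutativeRing using (fromCommutativeRing; _-Raw-AlmostCommutative⟶_)

-- Power series over ℤ

Series : Set
Series = ℕ → ℤ

infix 4 _≋_
_≋_ : Series → Series → Set
a ≋ b = ∀ n → a n ≡ b n

tailₛ : Series → Series
tailₛ a n = a (suc n)

-- The constant polynomial c, empty for c = 0, so that the constants 0 and 1 used by the ring
-- solver are cheb 0 and cheb 1 below on the nose.
constPoly : ℤ → Poly
constPoly (ℤ.+ 0) = []
constPoly c = c ∷ []

const : ℤ → Series
const c = coeff (constPoly c)

const-zero : ∀ c → const c 0 ≡ c
const-zero (ℤ.+ zero) = refl
const-zero (ℤ.+ suc _) = refl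
const-zero (ℤ.-[1+ _ ]) = refl

const-suc : ∀ c n → const c (suc n) ≡ 0ℤ
const-suc (ℤ.+ zero) n = refl
const-suc (ℤ.+ suc _) n = refl
const-suc (ℤ.-[1+ _ ]) n = refl

0ₛ 1ₛ : Series
0ₛ = coeff []
1ₛ = const 1ℤ

infixl 6 _+ₛ_
infixl 7 _*ₛ_

-- Addition and negation split on the index, like multiplication, so that `(a +ₛ b) n` is neutral
-- for a variable `n`: Agda can then infer the series arguments of congruence lemmas by unification.
_+ₛ_ : Series → Series → Series
(a +ₛ b) zero = a 0 +ℤ b 0
(a +ₛ b) (suc n) = a (suc n) +ℤ b (suc n)

-ₛ_ : Series → Series
(-ₛ a) zero = - a 0
(-ₛ a) (suc n) = - a (suc n)

_*ₛ_ : Series → Series → Series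
(a *ₛ b) zero = a 0 *ℤ b 0
(a *ₛ b) (suc n) = a 0 *ℤ b (suc n) +ℤ (tailₛ a *ₛ b) n

+ₛ-pointwise : ∀ a b n → (a +ₛ b) n ≡ a n +ℤ b n
+ₛ-pointwise a b zero = refl
+ₛ-pointwise a b (suc n) = refl

-ₛ-pointwise : ∀ a n → (-ₛ a) n ≡ - a n
-ₛ-pointwise a zero = refl
-ₛ-pointwise a (suc n) = refl

+ₛ-tail : ∀ a b → tailₛ (a +ₛ b) ≋ tailₛ a +ₛ tailₛ b
+ₛ-tail a b n = sym (+ₛ-pointwise (tailₛ a) (tailₛ b) n)

+ₛ-cong : ∀ {a a′ b b′} → a ≋ a′ → b ≋ b′ → a +ₛ b ≋ a′ +ₛ b′
+ₛ-cong a≋ b≋ zero = cong₂ _+ℤ_ (a≋ 0) (b≋ 0)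
+ₛ-cong a≋ b≋ (suc n) = cong₂ _+ℤ_ (a≋ (suc n)) (b≋ (suc n))

+ₛ-isAbelianGroup : IsAbelianGroup _≋_ _+ₛ_ 0ₛ -ₛ_
+ₛ-isAbelianGroup = record
  { isGroup = record
    { isMonoid = record
      { isSemigroup = record
        { isMagma = record
          { isEquivalence = record { refl = λ _ → refl ; sym = λ e n → sym (e n) ; trans = λ e f n → trans (e n) (f n) }
          ; ∙-cong = +ₛ-cong
          }
        ; assoc = λ { a b c zero → ℤ.+-assoc (a 0) (b 0) (c 0) ; a b c (suc n) → ℤ.+-assoc (a (suc n)) (b (suc n)) (c (suc n)) }
        }
      ; identity = (λ { a zero → ℤ.+-identityˡ (a 0) ; a (suc n) → ℤ.+-identityˡ (a (suc n)) })
                 , (λ { a zero → ℤ.+-identityʳ (a 0) ; a (suc n) → ℤ.+-identityʳ (a (suc n)) })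
      }
    ; inverse = (λ { a zero → ℤ.+-inverseˡ (a 0) ; a (suc n) → ℤ.+-inverseˡ (a (suc n)) })
              , (λ { a zero → ℤ.+-inverseʳ (a 0) ; a (suc n) → ℤ.+-inverseʳ (a (suc n)) })
    ; ⁻¹-cong = λ { e zero → cong -_ (e 0) ; e (suc n) → cong -_ (e (suc n)) }
    }
  ; comm = λ { a b zero → ℤ.+-comm (a 0) (b 0) ; a b (suc n) → ℤ.+-comm (a (suc n)) (b (suc n)) }
  }

*ₛ-cong : ∀ {a a′ b b′} → a ≋ a′ → b ≋ b′ → a *ₛ b ≋ a′ *ₛ b′
*ₛ-cong a≋ b≋ zero = cong₂ _*ℤ_ (a≋ 0) (b≋ 0)
*ₛ-cong a≋ b≋ (suc n) = cong₂ _+ℤ_ (cong₂ _*ℤ_ (a≋ 0) (b≋ (suc n))) (*ₛ-cong (λ m → a≋ (suc m)) b≋ n)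

*ₛ-zeroˡ : ∀ b → 0ₛ *ₛ b ≋ 0ₛ
*ₛ-zeroˡ b zero = refl
*ₛ-zeroˡ b (suc n) = trans (ℤ.+-identityˡ _) (*ₛ-zeroˡ b n)

*ₛ-identityˡ : ∀ b → 1ₛ *ₛ b ≋ b
*ₛ-identityˡ b zero = ℤ.*-identityˡ (b 0)
*ₛ-identityˡ b (suc n) = trans (cong₂ _+ℤ_ (ℤ.*-identityˡ (b (suc n))) (*ₛ-zeroˡ b n)) (ℤ.+-identityʳ (b (suc n)))

*ₛ-distribʳ : ∀ a b c → (a +ₛ b) *ₛ c ≋ a *ₛ c +ₛ b *ₛ c
*ₛ-distribʳ a b c zero = ℤ.*-distribʳ-+ (c 0) (a 0) (b 0)
*ₛ-distribʳ a b c (suc n) = begin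
  (a 0 +ℤ b 0) *ℤ c (suc n) +ℤ (tailₛ (a +ₛ b) *ₛ c) n
    ≡⟨ cong ((a 0 +ℤ b 0) *ℤ c (suc n) +ℤ_) (*ₛ-cong (+ₛ-tail a b) (λ _ → refl) n) ⟩
  (a 0 +ℤ b 0) *ℤ c (suc n) +ℤ ((tailₛ a +ₛ tailₛ b) *ₛ c) n
    ≡⟨ cong ((a 0 +ℤ b 0) *ℤ c (suc n) +ℤ_) (trans (*ₛ-distribʳ (tailₛ a) (tailₛ b) c n) (+ₛ-pointwise _ _ n)) ⟩
  (a 0 +ℤ b 0) *ℤ c (suc n) +ℤ ((tailₛ a *ₛ c) n +ℤ (tailₛ b *ₛ c) n)
    ≡⟨ lemma (a 0) (b 0) (c (suc n)) _ _ ⟩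
  (a 0 *ℤ c (suc n) +ℤ (tailₛ a *ₛ c) n) +ℤ (b 0 *ℤ c (suc n) +ℤ (tailₛ b *ₛ c) n) ∎
  where
  open ≡-Reasoning
  lemma : ∀ p q r s t → (p +ℤ q) *ℤ r +ℤ (s +ℤ t) ≡ (p *ℤ r +ℤ s) +ℤ (q *ℤ r +ℤ t)
  lemma = solve-∀

*ₛ-comm : ∀ a b → a *ₛ b ≋ b *ₛ a
*ₛ-comm a b zero = ℤ.*-comm (a 0) (b 0)
*ₛ-comm a b (suc zero) = lemma (a 0) (a 1) (b 0) (b 1)
  where
  lemma : ∀ p q r s → p *ℤ s +ℤ q *ℤ r ≡ r *ℤ q +ℤ s *ℤ p
  lemma = solve-∀
*ₛ-comm a b (suc (suc n)) = begin
  a 0 *ℤ b (2 + n) +ℤ (tailₛ a *ₛ b) (suc n)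
    ≡⟨ cong (a 0 *ℤ b (2 + n) +ℤ_) (*ₛ-comm (tailₛ a) b (suc n)) ⟩
  a 0 *ℤ b (2 + n) +ℤ (b 0 *ℤ a (2 + n) +ℤ (tailₛ b *ₛ tailₛ a) n)
    ≡⟨ cong (λ t → a 0 *ℤ b (2 + n) +ℤ (b 0 *ℤ a (2 + n) +ℤ t)) (*ₛ-comm (tailₛ b) (tailₛ a) n) ⟩
  a 0 *ℤ b (2 + n) +ℤ (b 0 *ℤ a (2 + n) +ℤ (tailₛ a *ₛ tailₛ b) n)
    ≡⟨ lemma (a 0 *ℤ b (2 + n)) (b 0 *ℤ a (2 + n)) ((tailₛ a *ₛ tailₛ b) n) ⟩
  b 0 *ℤ a (2 + n) +ℤ (a 0 *ℤ b (2 + n) +ℤ (tailₛ a *ₛ tailₛ b) n)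
    ≡⟨ cong (b 0 *ℤ a (2 + n) +ℤ_) (*ₛ-comm a (tailₛ b) (suc n)) ⟩
  b 0 *ℤ a (2 + n) +ℤ (tailₛ b *ₛ a) (suc n) ∎
  where
  open ≡-Reasoning
  lemma : ∀ p q r → p +ℤ (q +ℤ r) ≡ q +ℤ (p +ℤ r)
  lemma = solve-∀

scaleₛ : ℤ → Series → Series
scaleₛ c a n = c *ℤ a n

*ₛ-scaleˡ : ∀ c a b → scaleₛ c a *ₛ b ≋ scaleₛ c (a *ₛ b)
*ₛ-scaleˡ c a b zero = ℤ.*-assoc c (a 0) (b 0)
*ₛ-scaleˡ c a b (suc n) =
  trans (cong₂ _+ℤ_ (ℤ.*-assoc c (a 0) (b (suc n))) (*ₛ-scaleˡ c (tailₛ a) b n))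
        (sym (ℤ.*-distribˡ-+ c (a 0 *ℤ b (suc n)) ((tailₛ a *ₛ b) n)))

scaleₛ-neg : ∀ a → scaleₛ (-1ℤ) a ≋ -ₛ a
scaleₛ-neg a zero = ℤ.-1*i≡-i (a 0)
scaleₛ-neg a (suc n) = ℤ.-1*i≡-i (a (suc n))

*ₛ-assoc : ∀ a b c → (a *ₛ b) *ₛ c ≋ a *ₛ (b *ₛ c)
*ₛ-assoc a b c zero = ℤ.*-assoc (a 0) (b 0) (c 0)
*ₛ-assoc a b c (suc n) = begin
  (a 0 *ℤ b 0) *ℤ c (suc n) +ℤ (tailₛ (a *ₛ b) *ₛ c) n
    ≡⟨ cong ((a 0 *ℤ b 0) *ℤ c (suc n) +ℤ_) (*ₛ-cong tail≋ (λ _ → refl) n) ⟩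
  (a 0 *ℤ b 0) *ℤ c (suc n) +ℤ ((scaleₛ (a 0) (tailₛ b) +ₛ tailₛ a *ₛ b) *ₛ c) n
    ≡⟨ cong ((a 0 *ℤ b 0) *ℤ c (suc n) +ℤ_)
            (trans (*ₛ-distribʳ (scaleₛ (a 0) (tailₛ b)) (tailₛ a *ₛ b) c n) (+ₛ-pointwise _ _ n)) ⟩
  (a 0 *ℤ b 0) *ℤ c (suc n) +ℤ ((scaleₛ (a 0) (tailₛ b) *ₛ c) n +ℤ ((tailₛ a *ₛ b) *ₛ c) n)
    ≡⟨ cong₂ (λ s t → (a 0 *ℤ b 0) *ℤ c (suc n) +ℤ (s +ℤ t))
             (*ₛ-scaleˡ (a 0) (tailₛ b) c n) (*ₛ-assoc (tailₛ a) b c n) ⟩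
  (a 0 *ℤ b 0) *ℤ c (suc n) +ℤ (a 0 *ℤ (tailₛ b *ₛ c) n +ℤ (tailₛ a *ₛ (b *ₛ c)) n)
    ≡⟨ lemma (a 0) (b 0) (c (suc n)) _ _ ⟩
  a 0 *ℤ (b 0 *ℤ c (suc n) +ℤ (tailₛ b *ₛ c) n) +ℤ (tailₛ a *ₛ (b *ₛ c)) n ∎
  where
  open ≡-Reasoning
  lemma : ∀ p q r s t → (p *ℤ q) *ℤ r +ℤ (p *ℤ s +ℤ t) ≡ p *ℤ (q *ℤ r +ℤ s) +ℤ t
  lemma = solve-∀
  tail≋ : tailₛ (a *ₛ b) ≋ scaleₛ (a 0) (tailₛ b) +ₛ tailₛ a *ₛ b
  tail≋ m = sym (+ₛ-pointwise _ _ m)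

*ₛ-distribˡ : ∀ a b c → a *ₛ (b +ₛ c) ≋ a *ₛ b +ₛ a *ₛ c
*ₛ-distribˡ a b c n = trans (*ₛ-comm a (b +ₛ c) n) (trans (*ₛ-distribʳ b c a n) (+ₛ-cong (*ₛ-comm b a) (*ₛ-comm c a) n))

seriesRing : CommutativeRing 0ℓ 0ℓ
seriesRing = record
  { Carrier = Series
  ; _≈_ = _≋_
  ; _+_ = _+ₛ_
  ; _*_ = _*ₛ_
  ; -_ = -ₛ_
  ; 0# = 0ₛ
  ; 1# = 1ₛ
  ; isCommutativeRing = record
    { isRing = record
      { +-isAbelianGroup = +ₛ-isAbelianGroup
      ; *-cong = *ₛ-cong
      ; *-assoc = *ₛ-assoc
      ; *-identity = *ₛ-identityˡ , λ a n → trans (*ₛ-comm a 1ₛ n) (*ₛ-identityˡ a n)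
      ; distrib = *ₛ-distribˡ , λ a b c → *ₛ-distribʳ b c a
      }
    ; *-comm = *ₛ-comm
    }
  }


open CommutativeRing seriesRing using (+-cong; *-cong; -‿cong; *-assoc; *-comm)
  renaming (_-_ to _-ₛ_; refl to ≋-refl; sym to ≋-sym; trans to ≋-trans)
module ≋-Reasoning = Relation.Binary.Reasoning.Setoid (CommutativeRing.setoid seriesRing)

-- The integers act on series as constants; this lets the ring solver use integer coefficients.
private
  constMorphism : ℤ.+-*-rawRing -Raw-AlmostCommutative⟶ fromCommutativeRing seriesRing
  constMorphism = record
    { ⟦_⟧ = const
    ; +-homo = +-homo
    ; *-homo = *-homo
    ; -‿homo = -‿homo
    ; 0-homo = λ _ → refl
    ; 1-homo = λ _ → refl
    }
    where
    +-homo : ∀ a b → const (a +ℤ b) ≋ const a +ₛ const b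
    +-homo a b zero = trans (const-zero (a +ℤ b)) (sym (cong₂ _+ℤ_ (const-zero a) (const-zero b)))
    +-homo a b (suc n) = trans (const-suc (a +ℤ b) n) (sym (cong₂ _+ℤ_ (const-suc a n) (const-suc b n)))

    *-homo : ∀ a b → const (a *ℤ b) ≋ const a *ₛ const b
    *-homo a b zero = trans (const-zero (a *ℤ b)) (sym (cong₂ _*ℤ_ (const-zero a) (const-zero b)))
    *-homo a b (suc n) = trans (const-suc (a *ℤ b) n) (sym (cong₂ _+ℤ_ head tail))
      where
      head : const a 0 *ℤ const b (suc n) ≡ 0ℤ
      head = trans (cong (const a 0 *ℤ_) (const-suc b n)) (ℤ.*-zeroʳ (const a 0))
      tail : (tailₛ (const a) *ₛ const b) n ≡ 0ℤ
      tail = trans (*ₛ-cong (const-suc a) (λ _ → refl) n) (*ₛ-zeroˡ (const b) n)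

    -‿homo : ∀ a → const (- a) ≋ -ₛ const a
    -‿homo a zero = trans (const-zero (- a)) (cong -_ (sym (const-zero a)))
    -‿homo a (suc n) = trans (const-suc (- a) n) (sym (cong -_ (const-suc a n)))

  constEquality? : ∀ a b → Maybe (const a ≋ const b)
  constEquality? a b with a ℤ.≟ b
  ... | yes refl = just λ _ → refl
  ... | no _ = nothing

open import Algebra.Solver.Ring ℤ.+-*-rawRing (fromCommutativeRing seriesRing) constMorphism constEquality?

partialConv : Series → Series → ℕ → ℕ → ℤ
partialConv a b n zero = 0ℤ
partialConv a b n (suc i) = partialConv a b n i +ℤ a i *ℤ b (n ∸ i)

-- `conv` sums through a local function that cannot be named; `go≡` recovers it by unification,
-- which needs the bound `n` to be a variable (hence the `with` generalising `suc i` and `_+ℤ_`).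
module _ (a b : Series) where
  mutual
    conv≡partialConv : ∀ n → conv a b n ≡ partialConv a b n (suc n)
    conv≡partialConv zero = refl
    conv≡partialConv (suc i) with suc i | _+ℤ_
    ... | n | _+_ = cong (λ s → (s + (a i *ℤ b (n ∸ i))) + (a n *ℤ b (i ∸ i))) (go≡ n i)

    private
      go≡ : ∀ n i → _ ≡ partialConv a b n i
      go≡ n zero = refl
      go≡ n (suc i) = cong (_+ℤ a i *ℤ b (n ∸ i)) (go≡ n i)

partialConv-tail : ∀ a b n i →
  partialConv a b (suc n) (suc i) ≡ a 0 *ℤ b (suc n) +ℤ partialConv (tailₛ a) b n i
partialConv-tail a b n zero = trans (ℤ.+-identityˡ (a 0 *ℤ b (suc n))) (sym (ℤ.+-identityʳ (a 0 *ℤ b (suc n))))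
partialConv-tail a b n (suc i) =
  trans (cong (_+ℤ a (suc i) *ℤ b (n ∸ i)) (partialConv-tail a b n i))
        (ℤ.+-assoc (a 0 *ℤ b (suc n)) (partialConv (tailₛ a) b n i) (a (suc i) *ℤ b (n ∸ i)))

*ₛ≡partialConv : ∀ a b n → (a *ₛ b) n ≡ partialConv a b n (suc n)
*ₛ≡partialConv a b zero = sym (ℤ.+-identityˡ _)
*ₛ≡partialConv a b (suc n) =
  trans (cong (a 0 *ℤ b (suc n) +ℤ_) (*ₛ≡partialConv (tailₛ a) b n)) (sym (partialConv-tail a b n (suc n)))

conv≡*ₛ : ∀ a b n → conv a b n ≡ (a *ₛ b) n
conv≡*ₛ a b n = trans (conv≡partialConv a b n) (sym (*ₛ≡partialConv a b n))

X : Series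
X 1 = 1ℤ
X _ = 0ℤ

X^_ : ℕ → Series
X^ zero = 1ₛ
X^ suc k = X *ₛ X^ k

X*ₛ-suc : ∀ a n → (X *ₛ a) (suc n) ≡ a n
X*ₛ-suc a n = trans (ℤ.+-identityˡ _) (trans (*ₛ-cong tailX≋1 ≋-refl n) (*ₛ-identityˡ a n))
  where
  tailX≋1 : tailₛ X ≋ 1ₛ
  tailX≋1 zero = refl
  tailX≋1 (suc _) = refl

X^-+ : ∀ m n → X^ (m + n) ≋ X^ m *ₛ X^ n
X^-+ zero n = ≋-sym (*ₛ-identityˡ (X^ n))
X^-+ (suc m) n = ≋-trans (*-cong (≋-refl {X}) (X^-+ m n)) (≋-sym (*ₛ-assoc X (X^ m) (X^ n)))

coeff-⊕ : ∀ p q → coeff (p ⊕ q) ≋ coeff p +ₛ coeff q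
coeff-⊕ p q n = trans (pointwise p q n) (sym (+ₛ-pointwise (coeff p) (coeff q) n))
  where
  pointwise : ∀ p q n → coeff (p ⊕ q) n ≡ coeff p n +ℤ coeff q n
  pointwise [] q n = sym (ℤ.+-identityˡ (coeff q n))
  pointwise (a ∷ p) [] zero = sym (ℤ.+-identityʳ a)
  pointwise (a ∷ p) [] (suc n) = sym (ℤ.+-identityʳ (coeff p n))
  pointwise (a ∷ p) (b ∷ q) zero = refl
  pointwise (a ∷ p) (b ∷ q) (suc n) = pointwise p q n

coeff-scale : ∀ c p → coeff (scale c p) ≋ scaleₛ c (coeff p)
coeff-scale c [] n = sym (ℤ.*-zeroʳ c)
coeff-scale c (a ∷ p) zero = refl
coeff-scale c (a ∷ p) (suc n) = coeff-scale c p n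

coeff-⊗ : ∀ p q → coeff (p ⊗ q) ≋ coeff p *ₛ coeff q
coeff-⊗ [] q n = sym (*ₛ-zeroˡ (coeff q) n)
coeff-⊗ (a ∷ p) q zero =
  trans (coeff-⊕ (scale a q) (0ℤ ∷ (p ⊗ q)) zero) (trans (cong (_+ℤ 0ℤ) (coeff-scale a q zero)) (ℤ.+-identityʳ (a *ℤ coeff q 0)))
coeff-⊗ (a ∷ p) q (suc n) =
  trans (coeff-⊕ (scale a q) (0ℤ ∷ (p ⊗ q)) (suc n)) (cong₂ _+ℤ_ (coeff-scale a q (suc n)) (coeff-⊗ p q n))

coeff-shift : ∀ k p → coeff (shift k p) ≋ X^ k *ₛ coeff p
coeff-shift zero p n = sym (*ₛ-identityˡ (coeff p) n)
coeff-shift (suc k) p zero = sym (*ₛ-assoc X (X^ k) (coeff p) zero)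
coeff-shift (suc k) p (suc n) =
  trans (coeff-shift k p n) (sym (trans (*ₛ-assoc X (X^ k) (coeff p) (suc n)) (X*ₛ-suc (X^ k *ₛ coeff p) n)))

-- Rescaled Chebyshev polynomials

-- cheb (suc p) is the coefficient series of R p, so cheb p = x^((p-1)/2) U_(p-1)(1/(2√x)).
cheb : ℕ → Series
cheb p = coeff (proj₁ (Rpair p))

cheb-rec : ∀ p → cheb (2 + p) ≋ cheb (1 + p) -ₛ X *ₛ cheb p
cheb-rec p = begin
  coeff (R p ⊕ shift 1 negPrevious)         ≈⟨ coeff-⊕ (R p) (shift 1 negPrevious) ⟩
  cheb (1 + p) +ₛ coeff (shift 1 negPrevious) ≈⟨ +-cong ≋-refl (coeff-shift 1 negPrevious) ⟩
  cheb (1 + p) +ₛ X^ 1 *ₛ coeff negPrevious   ≈⟨ +-cong ≋-refl (*-cong ≋-refl negate) ⟩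
  cheb (1 + p) +ₛ X^ 1 *ₛ (-ₛ cheb p)
    ≈⟨ solve 3 (λ c x d → c :+ (x :* con 1ℤ) :* (:- d) := c :- x :* d) ≋-refl (cheb (1 + p)) X (cheb p) ⟩
  cheb (1 + p) -ₛ X *ₛ cheb p ∎
  where
  open ≋-Reasoning
  negPrevious = scale (-1ℤ) (proj₁ (Rpair p))
  negate : coeff negPrevious ≋ -ₛ cheb p
  negate n = trans (coeff-scale (-1ℤ) (proj₁ (Rpair p)) n) (scaleₛ-neg (cheb p) n)

cheb-cong : ∀ {i j} → i ≡ j → cheb i ≋ cheb j
cheb-cong refl = ≋-refl

cheb-+ : ∀ m n → cheb (suc (m + n)) ≋ cheb (suc m) *ₛ cheb (suc n) -ₛ X *ₛ (cheb m *ₛ cheb n)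
cheb-+ zero n = solve 3 (λ c d x → c := con 1ℤ :* c :- x :* (con 0ℤ :* d)) ≋-refl (cheb (suc n)) (cheb n) X
cheb-+ (suc m) n = begin
  cheb (suc (suc m + n))                                                     ≈⟨ cheb-cong (cong suc (sym (ℕ.+-suc m n))) ⟩
  cheb (suc (m + suc n))                                                     ≈⟨ cheb-+ m (suc n) ⟩
  cheb (suc m) *ₛ cheb (2 + n) -ₛ X *ₛ (cheb m *ₛ cheb (suc n))              ≈⟨ +-cong (*-cong ≋-refl (cheb-rec n)) ≋-refl ⟩
  cheb (suc m) *ₛ (cheb (suc n) -ₛ X *ₛ cheb n) -ₛ X *ₛ (cheb m *ₛ cheb (suc n))
    ≈⟨ solve 5 (λ a b c d x → a :* (c :- x :* d) :- x :* (b :* c) := (a :- x :* b) :* c :- x :* (a :* d)) ≋-refl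
               (cheb (suc m)) (cheb m) (cheb (suc n)) (cheb n) X ⟩
  (cheb (suc m) -ₛ X *ₛ cheb m) *ₛ cheb (suc n) -ₛ X *ₛ (cheb (suc m) *ₛ cheb n)
    ≈⟨ +-cong (*-cong (≋-sym (cheb-rec m)) ≋-refl) ≋-refl ⟩
  cheb (2 + m) *ₛ cheb (suc n) -ₛ X *ₛ (cheb (suc m) *ₛ cheb n)               ∎
  where open ≋-Reasoning

-- The Casoratian of the recurrence, whose characteristic roots multiply to X.
cheb-casoratian : ∀ n d → cheb (n + d) *ₛ cheb (suc n) -ₛ cheb (suc (n + d)) *ₛ cheb n ≋ X^ n *ₛ cheb d
cheb-casoratian zero d = solve 2 (λ a b → a :* con 1ℤ :- b :* con 0ℤ := con 1ℤ :* a) ≋-refl (cheb d) (cheb (suc d))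
cheb-casoratian (suc n) d = begin
  cheb (suc n + d) *ₛ cheb (2 + n) -ₛ cheb (2 + n + d) *ₛ cheb (suc n)
    ≈⟨ +-cong (*-cong ≋-refl (cheb-rec n)) (-‿cong (*-cong (cheb-rec (n + d)) ≋-refl)) ⟩
  cheb (suc n + d) *ₛ (cheb (suc n) -ₛ X *ₛ cheb n) -ₛ (cheb (suc n + d) -ₛ X *ₛ cheb (n + d)) *ₛ cheb (suc n)
    ≈⟨ solve 5 (λ a b c d x → a :* (c :- x :* d) :- (a :- x :* b) :* c := x :* (b :* c :- a :* d)) ≋-refl
               (cheb (suc n + d)) (cheb (n + d)) (cheb (suc n)) (cheb n) X ⟩
  X *ₛ (cheb (n + d) *ₛ cheb (suc n) -ₛ cheb (suc n + d) *ₛ cheb n)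
    ≈⟨ *-cong ≋-refl (cheb-casoratian n d) ⟩
  X *ₛ (X^ n *ₛ cheb d)
    ≈⟨ ≋-sym (*-assoc X (X^ n) (cheb d)) ⟩
  X^ suc n *ₛ cheb d ∎
  where open ≋-Reasoning

-- A is the power series cheb j / cheb (j + 1), stated without division.
IsChebQuotient : ℕ → Series → Set
IsChebQuotient j A = A *ₛ cheb (suc j) ≋ cheb j

cheb-denominator : ∀ a c →
  cheb (2 + a + c) ≋ cheb (suc a) *ₛ cheb (suc c) -ₛ X *ₛ (cheb a *ₛ cheb (suc c) +ₛ cheb (suc a) *ₛ cheb c)
cheb-denominator a c = begin
  cheb (2 + a + c)                                                    ≈⟨ cheb-+ (suc a) c ⟩
  cheb (2 + a) *ₛ cheb (suc c) -ₛ X *ₛ (cheb (suc a) *ₛ cheb c)      ≈⟨ +-cong (*-cong (cheb-rec a) ≋-refl) ≋-refl ⟩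
  (cheb (suc a) -ₛ X *ₛ cheb a) *ₛ cheb (suc c) -ₛ X *ₛ (cheb (suc a) *ₛ cheb c)
    ≈⟨ solve 5 (λ P p Q q x → (P :- x :* p) :* Q :- x :* (P :* q) := P :* Q :- x :* (p :* Q :+ P :* q)) ≋-refl
               (cheb (suc a)) (cheb a) (cheb (suc c)) (cheb c) X ⟩
  cheb (suc a) *ₛ cheb (suc c) -ₛ X *ₛ (cheb a *ₛ cheb (suc c) +ₛ cheb (suc a) *ₛ cheb c) ∎
  where open ≋-Reasoning

-- Multiplying by cheb (a + 1) cheb (c + 1) turns the coefficient 1 - X (A + C) of Y into cheb (a + c + 2).
linear-equation : ∀ {a c A C K Y} → IsChebQuotient a A → IsChebQuotient c C →
  Y ≋ 1ₛ +ₛ X *ₛ (A *ₛ Y +ₛ C *ₛ Y +ₛ K) →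
  Y *ₛ cheb (2 + a + c) ≋ cheb (suc a) *ₛ cheb (suc c) *ₛ (1ₛ +ₛ X *ₛ K)
linear-equation {a} {c} {A} {C} {K} {Y} hA hC hY = begin
  Y *ₛ cheb (2 + a + c)
    ≈⟨ *-cong ≋-refl (cheb-denominator a c) ⟩
  Y *ₛ (P *ₛ Q -ₛ X *ₛ (cheb a *ₛ Q +ₛ P *ₛ cheb c))
    ≈⟨ *-cong ≋-refl (+-cong ≋-refl (-‿cong (*-cong ≋-refl (+-cong (*-cong (≋-sym hA) ≋-refl) (*-cong ≋-refl (≋-sym hC)))))) ⟩
  Y *ₛ (P *ₛ Q -ₛ X *ₛ (A *ₛ P *ₛ Q +ₛ P *ₛ (C *ₛ Q)))
    ≈⟨ solve 6 (λ y a c P Q x → y :* (P :* Q :- x :* (a :* P :* Q :+ P :* (c :* Q))) := (y :- x :* (a :* y :+ c :* y)) :* (P :* Q))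
               ≋-refl Y A C P Q X ⟩
  (Y -ₛ X *ₛ (A *ₛ Y +ₛ C *ₛ Y)) *ₛ (P *ₛ Q)
    ≈⟨ *-cong (+-cong hY ≋-refl) ≋-refl ⟩
  (1ₛ +ₛ X *ₛ (A *ₛ Y +ₛ C *ₛ Y +ₛ K) -ₛ X *ₛ (A *ₛ Y +ₛ C *ₛ Y)) *ₛ (P *ₛ Q)
    ≈⟨ *-cong (solve 5 (λ y a c k x → con 1ℤ :+ x :* (a :* y :+ c :* y :+ k) :- x :* (a :* y :+ c :* y) := con 1ℤ :+ x :* k)
                       ≋-refl Y A C K X) ≋-refl ⟩
  (1ₛ +ₛ X *ₛ K) *ₛ (P *ₛ Q)
    ≈⟨ *-comm (1ₛ +ₛ X *ₛ K) (P *ₛ Q) ⟩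
  P *ₛ Q *ₛ (1ₛ +ₛ X *ₛ K) ∎
  where
  open ≋-Reasoning
  P = cheb (suc a)
  Q = cheb (suc c)

0-isChebQuotient : IsChebQuotient 0 0ₛ
0-isChebQuotient = *ₛ-zeroˡ (cheb 1)

F-equations⇒isChebQuotient : ∀ {F : ℕ → Series} → F 0 ≋ 0ₛ → (∀ j → F (suc j) ≋ 1ₛ +ₛ X *ₛ (F j *ₛ F (suc j))) →
  ∀ j → IsChebQuotient j (F j)
F-equations⇒isChebQuotient {F} F₀ Fₛ zero = ≋-trans (*-cong F₀ ≋-refl) 0-isChebQuotient
F-equations⇒isChebQuotient {F} F₀ Fₛ (suc j) = begin
  F (suc j) *ₛ cheb (2 + j)       ≈⟨ *-cong ≋-refl (cheb-cong (cong (λ i → 2 + i) (sym (ℕ.+-identityʳ j)))) ⟩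
  F (suc j) *ₛ cheb (2 + j + 0)   ≈⟨ linear-equation {j} {0} (F-equations⇒isChebQuotient F₀ Fₛ j) 0-isChebQuotient equation ⟩
  cheb (suc j) *ₛ 1ₛ *ₛ (1ₛ +ₛ X *ₛ 0ₛ)
    ≈⟨ solve 2 (λ p x → p :* con 1ℤ :* (con 1ℤ :+ x :* con 0ℤ) := p) ≋-refl (cheb (suc j)) X ⟩
  cheb (suc j)                     ∎
  where
  open ≋-Reasoning
  equation : F (suc j) ≋ 1ₛ +ₛ X *ₛ (F j *ₛ F (suc j) +ₛ 0ₛ *ₛ F (suc j) +ₛ 0ₛ)
  equation = ≋-trans (Fₛ j) (solve 3 (λ x f g → con 1ℤ :+ x :* (f :* g) := con 1ℤ :+ x :* (f :* g :+ con 0ℤ :* g :+ con 0ℤ))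
                                     ≋-refl X (F j) (F (suc j)))

G-equation⇒isChebQuotient : ∀ {a b A B G} → IsChebQuotient a A → IsChebQuotient b B →
  G ≋ 1ₛ +ₛ X *ₛ (A *ₛ G +ₛ G *ₛ B -ₛ A *ₛ B) → IsChebQuotient (suc (a + b)) G
G-equation⇒isChebQuotient {a} {b} {A} {B} {G} hA hB hG = begin
  G *ₛ cheb (2 + a + b)                                         ≈⟨ linear-equation {a} {b} hA hB equation ⟩
  cheb (suc a) *ₛ cheb (suc b) *ₛ (1ₛ +ₛ X *ₛ (-ₛ (A *ₛ B)))
    ≈⟨ solve 5 (λ P Q a b x → P :* Q :* (con 1ℤ :+ x :* (:- (a :* b))) := P :* Q :- x :* (a :* P :* (b :* Q)))
               ≋-refl (cheb (suc a)) (cheb (suc b)) A B X ⟩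
  cheb (suc a) *ₛ cheb (suc b) -ₛ X *ₛ (A *ₛ cheb (suc a) *ₛ (B *ₛ cheb (suc b)))
    ≈⟨ +-cong ≋-refl (-‿cong (*-cong ≋-refl (*-cong hA hB))) ⟩
  cheb (suc a) *ₛ cheb (suc b) -ₛ X *ₛ (cheb a *ₛ cheb b)       ≈⟨ ≋-sym (cheb-+ a b) ⟩
  cheb (suc (a + b))                                            ∎
  where
  open ≋-Reasoning
  equation : G ≋ 1ₛ +ₛ X *ₛ (A *ₛ G +ₛ B *ₛ G +ₛ -ₛ (A *ₛ B))
  equation = ≋-trans hG (solve 4 (λ x a b g →    con 1ℤ :+ x :* (a :* g :+ g :* b :- a :* b)
                                              := con 1ℤ :+ x :* (a :* g :+ b :* g :+ :- (a :* b)))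
                                 ≋-refl X A B G)

H-equation⇒identity : ∀ {a b g A C G₁ G₂ H} → IsChebQuotient a A → IsChebQuotient g C →
  IsChebQuotient (suc (a + b)) G₁ → IsChebQuotient (b + g) G₂ →
  H ≋ 1ₛ +ₛ X *ₛ (A *ₛ H +ₛ (G₁ -ₛ A) *ₛ G₂ +ₛ (H -ₛ G₁) *ₛ C) →
  H *ₛ (cheb (2 + a + b) *ₛ (cheb (2 + a + g) *ₛ cheb (suc (b + g))))
    ≋ cheb (2 + a + b) *ₛ (cheb (suc a + g) *ₛ cheb (suc (b + g))) +ₛ X^ (suc a + g) *ₛ (cheb b *ₛ cheb (suc b))
H-equation⇒identity {a} {b} {g} {A} {C} {G₁} {G₂} {H} hA hC hG₁ hG₂ hH = begin
  H *ₛ (S *ₛ (D *ₛ Q))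
    ≈⟨ solve 4 (λ h S D Q → h :* (S :* (D :* Q)) := h :* D :* (S :* Q)) ≋-refl H S D Q ⟩
  H *ₛ D *ₛ (S *ₛ Q)
    ≈⟨ *-cong (linear-equation {a} {g} hA hC equation) ≋-refl ⟩
  Pa *ₛ Pg *ₛ (1ₛ +ₛ X *ₛ ((G₁ -ₛ A) *ₛ G₂ -ₛ G₁ *ₛ C)) *ₛ (S *ₛ Q)
    ≈⟨ solve 9 (λ Pa Pg S Q a c g₁ g₂ x →
                   Pa :* Pg :* (con 1ℤ :+ x :* ((g₁ :- a) :* g₂ :- g₁ :* c)) :* (S :* Q)
                := S :* Pa :* Pg :* Q :+ x :* ((g₁ :* S :* Pa :- a :* Pa :* S) :* (g₂ :* Q) :* Pg :- g₁ :* S :* Pa :* (c :* Pg) :* Q))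
               ≋-refl Pa Pg S Q A C G₁ G₂ X ⟩
  S *ₛ Pa *ₛ Pg *ₛ Q +ₛ X *ₛ ((G₁ *ₛ S *ₛ Pa -ₛ A *ₛ Pa *ₛ S) *ₛ (G₂ *ₛ Q) *ₛ Pg -ₛ G₁ *ₛ S *ₛ Pa *ₛ (C *ₛ Pg) *ₛ Q)
    ≈⟨ +-cong ≋-refl (*-cong ≋-refl
         (+-cong (*-cong (*-cong (+-cong (*-cong hG₁ ≋-refl) (-‿cong (*-cong hA ≋-refl))) hG₂) ≋-refl)
                 (-‿cong (*-cong (*-cong (*-cong hG₁ ≋-refl) hC) ≋-refl)))) ⟩
  S *ₛ Pa *ₛ Pg *ₛ Q +ₛ X *ₛ ((s *ₛ Pa -ₛ pa *ₛ S) *ₛ q *ₛ Pg -ₛ s *ₛ Pa *ₛ pg *ₛ Q)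
    ≈⟨ solve 9 (λ Pa pa Pg pg S s Q q x →
                   S :* Pa :* Pg :* Q :+ x :* ((s :* Pa :- pa :* S) :* q :* Pg :- s :* Pa :* pg :* Q)
                := S :* (Pa :* Pg :- x :* (pa :* pg)) :* Q :+ x :* ((s :* Pa :- S :* pa) :* (q :* Pg :- Q :* pg)))
               ≋-refl Pa pa Pg pg S s Q q X ⟩
  S *ₛ (Pa *ₛ Pg -ₛ X *ₛ (pa *ₛ pg)) *ₛ Q +ₛ X *ₛ ((s *ₛ Pa -ₛ S *ₛ pa) *ₛ (q *ₛ Pg -ₛ Q *ₛ pg))
    ≈⟨ +-cong (*-cong (*-cong ≋-refl (≋-sym (cheb-+ a g))) ≋-refl) (*-cong ≋-refl (*-cong casoratian-ab casoratian-bg)) ⟩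
  S *ₛ cheb (suc a + g) *ₛ Q +ₛ X *ₛ (X^ a *ₛ cheb (suc b) *ₛ (X^ g *ₛ cheb b))
    ≈⟨ +-cong (*-assoc S (cheb (suc a + g)) Q)
              (solve 5 (λ x xa xg c d → x :* (xa :* d :* (xg :* c)) := x :* (xa :* xg) :* (c :* d))
                       ≋-refl X (X^ a) (X^ g) (cheb b) (cheb (suc b))) ⟩
  S *ₛ (cheb (suc a + g) *ₛ Q) +ₛ X *ₛ (X^ a *ₛ X^ g) *ₛ (cheb b *ₛ cheb (suc b))
    ≈⟨ +-cong ≋-refl (*-cong (*-cong ≋-refl (≋-sym (X^-+ a g))) ≋-refl) ⟩
  S *ₛ (cheb (suc a + g) *ₛ Q) +ₛ X^ (suc a + g) *ₛ (cheb b *ₛ cheb (suc b)) ∎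
  where
  open ≋-Reasoning
  Pa = cheb (suc a)
  pa = cheb a
  Pg = cheb (suc g)
  pg = cheb g
  S = cheb (2 + a + b)
  s = cheb (suc (a + b))
  Q = cheb (suc (b + g))
  q = cheb (b + g)
  D = cheb (2 + a + g)

  equation : H ≋ 1ₛ +ₛ X *ₛ (A *ₛ H +ₛ C *ₛ H +ₛ ((G₁ -ₛ A) *ₛ G₂ -ₛ G₁ *ₛ C))
  equation = ≋-trans hH (solve 6 (λ x a c g₁ g₂ h →
                                    con 1ℤ :+ x :* (a :* h :+ (g₁ :- a) :* g₂ :+ (h :- g₁) :* c)
                                 := con 1ℤ :+ x :* (a :* h :+ c :* h :+ ((g₁ :- a) :* g₂ :- g₁ :* c)))
                                 ≋-refl X A C G₁ G₂ H)

  casoratian-ab : s *ₛ Pa -ₛ S *ₛ pa ≋ X^ a *ₛ cheb (suc b)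
  casoratian-ab = ≋-trans (+-cong (*-cong (cheb-cong (sym (ℕ.+-suc a b))) ≋-refl)
                                  (-‿cong (*-cong (cheb-cong (cong suc (sym (ℕ.+-suc a b)))) ≋-refl)))
                          (cheb-casoratian a (suc b))

  casoratian-bg : q *ₛ Pg -ₛ Q *ₛ pg ≋ X^ g *ₛ cheb b
  casoratian-bg = ≋-trans (+-cong (*-cong (cheb-cong (ℕ.+-comm b g)) ≋-refl)
                                  (-‿cong (*-cong (cheb-cong (cong suc (ℕ.+-comm b g))) ≋-refl)))
                          (cheb-casoratian g b)

-- Pattern containment

T-ext : ∀ {x y} → (T x → T y) → (T y → T x) → x ≡ y
T-ext {false} {false} _ _ = refl
T-ext {false} {true} _ y⇒x = ⊥-elim (y⇒x _)
T-ext {true} {false} x⇒y _ = ⊥-elim (x⇒y _)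
T-ext {true} {true} _ _ = refl

++-∷-injective : ∀ {A : Set} {x : A} u v u′ v′ → x ∉ u → x ∉ u′ → u ++ x ∷ v ≡ u′ ++ x ∷ v′ →
  u ≡ u′ × v ≡ v′
++-∷-injective [] v [] v′ _ _ e = refl , List.∷-injectiveʳ e
++-∷-injective [] v (y ∷ u′) v′ _ x∉u′ e = ⊥-elim (x∉u′ (here (List.∷-injectiveˡ e)))
++-∷-injective (y ∷ u) v [] v′ x∉u _ e = ⊥-elim (x∉u (here (sym (List.∷-injectiveˡ e))))
++-∷-injective (y ∷ u) v (y′ ∷ u′) v′ x∉u x∉u′ e with List.∷-injective e
... | refl , e′ with ++-∷-injective u v u′ v′ (x∉u ∘ there) (x∉u′ ∘ there) e′
...   | refl , refl = refl , refl

++-≡-++ : ∀ (X Y τ₁ τ₂ : List ℕ) → X ++ Y ≡ τ₁ ++ τ₂ →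
  (∃ λ r → τ₁ ≡ X ++ r × Y ≡ r ++ τ₂) ⊎ (∃ λ r → X ≡ τ₁ ++ r × τ₂ ≡ r ++ Y)
++-≡-++ [] Y τ₁ τ₂ e = inj₁ (τ₁ , refl , e)
++-≡-++ (x ∷ X) Y [] τ₂ e = inj₂ (x ∷ X , refl , sym e)
++-≡-++ (x ∷ X) Y (y ∷ τ₁) τ₂ e with List.∷-injective e
... | refl , e′ with ++-≡-++ X Y τ₁ τ₂ e′
...   | inj₁ (r , p , q) = inj₁ (r , cong (x ∷_) p , q)
...   | inj₂ (r , p , q) = inj₂ (r , cong (x ∷_) p , q)

∈-subseqs⁺ : ∀ {xs ys} → xs ⊆ ys → xs ∈ subseqs ys
∈-subseqs⁺ [] = here refl
∈-subseqs⁺ {ys = y ∷ ys} (refl ∷ p) = ∈-++⁺ˡ (∈-map⁺ (y ∷_) (∈-subseqs⁺ p))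
∈-subseqs⁺ {ys = y ∷ ys} (y ∷ʳ p) = ∈-++⁺ʳ (map (y ∷_) (subseqs ys)) (∈-subseqs⁺ p)

∈-subseqs⁻ : ∀ {xs} ys → xs ∈ subseqs ys → xs ⊆ ys
∈-subseqs⁻ [] (here refl) = []
∈-subseqs⁻ (y ∷ ys) i with ∈-++⁻ (map (y ∷_) (subseqs ys)) i
... | inj₁ j with ∈-map⁻ (y ∷_) j
...   | _ , k , refl = refl ∷ ∈-subseqs⁻ ys k
∈-subseqs⁻ (y ∷ ys) i | inj₂ j = y ∷ʳ ∈-subseqs⁻ ys j

-- `T (contains α τ)`, wrapped in a record so that `α` and `τ` can be inferred from it.
record Contains (α τ : List ℕ) : Set where
  constructor mkContains
  field holds : T (contains α τ)

contains⁺ : ∀ {α τ s} → s ⊆ α → T (orderIso τ s) → Contains α τ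
contains⁺ s⊆α τ≅s = mkContains (any⁺ _ (lose (∈-subseqs⁺ s⊆α) τ≅s))

contains⁻ : ∀ {α τ} → Contains α τ → ∃ λ s → s ⊆ α × T (orderIso τ s)
contains⁻ {α} (mkContains c) with find (any⁻ _ (subseqs α) c)
... | s , s∈ , τ≅s = s , ∈-subseqs⁻ α s∈ , τ≅s

contains-[] : ∀ α → Contains α []
contains-[] α = contains⁺ (minimum α) _

contains-⊆ : ∀ {α β τ} → β ⊆ α → Contains β τ → Contains α τ
contains-⊆ β⊆α c with contains⁻ c
... | s , s⊆β , τ≅s = contains⁺ (⊆-trans s⊆β β⊆α) τ≅s

samePosition : ℕ → ℕ → ℕ × ℕ → Bool
samePosition a b p = ((a <ᵇ proj₁ p) ==ᵇ (b <ᵇ proj₂ p)) ∧ ((proj₁ p <ᵇ a) ==ᵇ (proj₂ p <ᵇ b))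

orderIso-length : ∀ τ s → T (orderIso τ s) → length τ ≡ length s
orderIso-length [] [] _ = refl
orderIso-length (a ∷ τ) (b ∷ s) τ≅s = cong suc (orderIso-length τ s (proj₂ (Equivalence.to T-∧ τ≅s)))

crossIso : List ℕ → List ℕ → List ℕ → List ℕ → Bool
crossIso (a ∷ as) (b ∷ bs) cs ds = all (samePosition a b) (zip cs ds) ∧ crossIso as bs cs ds
crossIso _ _ _ _ = true

zip-++ : ∀ (as bs cs ds : List ℕ) → length as ≡ length bs → zip (as ++ cs) (bs ++ ds) ≡ zip as bs ++ zip cs ds
zip-++ [] [] cs ds _ = refl
zip-++ (a ∷ as) (b ∷ bs) cs ds e = cong ((a , b) ∷_) (zip-++ as bs cs ds (ℕ.suc-injective e))

all-++ : ∀ {A : Set} (p : A → Bool) xs ys → all p (xs ++ ys) ≡ all p xs ∧ all p ys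
all-++ p [] ys = refl
all-++ p (x ∷ xs) ys with p x
... | true = all-++ p xs ys
... | false = refl

orderIso-++ : ∀ as bs cs ds → length as ≡ length bs →
  orderIso (as ++ cs) (bs ++ ds) ≡ (orderIso as bs ∧ crossIso as bs cs ds) ∧ orderIso cs ds
orderIso-++ [] [] cs ds _ = refl
orderIso-++ (a ∷ as) (b ∷ bs) cs ds e = begin
  all (samePosition a b) (zip (as ++ cs) (bs ++ ds)) ∧ orderIso (as ++ cs) (bs ++ ds)
    ≡⟨ cong₂ _∧_ (trans (cong (all (samePosition a b)) (zip-++ as bs cs ds e′)) (all-++ _ (zip as bs) (zip cs ds)))
                 (orderIso-++ as bs cs ds e′) ⟩
  (all (samePosition a b) (zip as bs) ∧ all (samePosition a b) (zip cs ds)) ∧ ((orderIso as bs ∧ crossIso as bs cs ds) ∧ orderIso cs ds)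
    ≡⟨ rearrange (all (samePosition a b) (zip as bs)) _ _ _ _ ⟩
  ((all (samePosition a b) (zip as bs) ∧ orderIso as bs) ∧ (all (samePosition a b) (zip cs ds) ∧ crossIso as bs cs ds))
    ∧ orderIso cs ds ∎
  where
  open ≡-Reasoning
  e′ = ℕ.suc-injective e
  rearrange : ∀ p q r s t → (p ∧ q) ∧ ((r ∧ s) ∧ t) ≡ ((p ∧ r) ∧ (q ∧ s)) ∧ t
  rearrange true true r s t = refl
  rearrange true false true s t = refl
  rearrange true false false s t = refl
  rearrange false q r s t = refl

T-∧-intro : ∀ {a b} → T a → T b → T (a ∧ b)
T-∧-intro p q = Equivalence.from T-∧ (p , q)

orderIso-++⁺ : ∀ as bs cs ds → T (orderIso as bs) → T (crossIso as bs cs ds) → T (orderIso cs ds) →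
  T (orderIso (as ++ cs) (bs ++ ds))
orderIso-++⁺ as bs cs ds as≅bs cross cs≅ds =
  subst T (sym (orderIso-++ as bs cs ds (orderIso-length as bs as≅bs))) (T-∧-intro (T-∧-intro as≅bs cross) cs≅ds)

orderIso-++⁻ : ∀ as bs cs ds → length as ≡ length bs → T (orderIso (as ++ cs) (bs ++ ds)) →
  T (orderIso as bs) × T (crossIso as bs cs ds) × T (orderIso cs ds)
orderIso-++⁻ as bs cs ds len ≅ with Equivalence.to T-∧ (subst T (orderIso-++ as bs cs ds len) ≅)
... | as≅bs∧cross , cs≅ds with Equivalence.to (T-∧ {orderIso as bs}) as≅bs∧cross
...   | as≅bs , cross = as≅bs , cross , cs≅ds

above below : List ℕ → List ℕ → Bool
above xs ys = all (λ x → all (λ y → y <ᵇ x) ys) xs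
below xs ys = all (λ x → all (λ y → x <ᵇ y) ys) xs

<ᵇ-asym : ∀ {m n} → T (m <ᵇ n) → (n <ᵇ m) ≡ false
<ᵇ-asym {m} {n} m<n with n <ᵇ m in eq
... | false = refl
... | true = ⊥-elim (ℕ.<-asym (ℕ.<ᵇ⇒< m n m<n) (ℕ.<ᵇ⇒< n m (subst T (sym eq) _)))

T⇒≡true : ∀ {b} → T b → b ≡ true
T⇒≡true = Equivalence.to T-≡

samePosition-below : ∀ a b c d → T (d <ᵇ b) → samePosition a b (c , d) ≡ (c <ᵇ a)
samePosition-below a b c d d<b rewrite <ᵇ-asym {d} {b} d<b | T⇒≡true d<b with c <ᵇ a in eq
... | false = ∧-zeroʳ ((a <ᵇ c) ==ᵇ false)
... | true rewrite <ᵇ-asym {c} {a} (subst T (sym eq) _) = refl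

samePosition-above : ∀ a b c d → T (b <ᵇ d) → samePosition a b (c , d) ≡ (a <ᵇ c)
samePosition-above a b c d b<d rewrite <ᵇ-asym {b} {d} b<d | T⇒≡true b<d with a <ᵇ c in eq
... | false = refl
... | true rewrite <ᵇ-asym {a} {c} (subst T (sym eq) _) = refl

all-samePosition-below : ∀ a b cs ds → length cs ≡ length ds → T (all (λ y → y <ᵇ b) ds) →
  all (samePosition a b) (zip cs ds) ≡ all (λ y → y <ᵇ a) cs
all-samePosition-below a b [] [] _ _ = refl
all-samePosition-below a b (c ∷ cs) (d ∷ ds) e ds<b with Equivalence.to T-∧ ds<b
... | d<b , ds′<b = cong₂ _∧_ (samePosition-below a b c d d<b) (all-samePosition-below a b cs ds (ℕ.suc-injective e) ds′<b)

all-samePosition-above : ∀ a b cs ds → length cs ≡ length ds → T (all (λ y → b <ᵇ y) ds) →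
  all (samePosition a b) (zip cs ds) ≡ all (λ y → a <ᵇ y) cs
all-samePosition-above a b [] [] _ _ = refl
all-samePosition-above a b (c ∷ cs) (d ∷ ds) e b<ds with Equivalence.to T-∧ b<ds
... | b<d , b<ds′ = cong₂ _∧_ (samePosition-above a b c d b<d) (all-samePosition-above a b cs ds (ℕ.suc-injective e) b<ds′)

crossIso-above : ∀ τ s τ′ s′ → length τ ≡ length s → length τ′ ≡ length s′ → T (above s s′) →
  crossIso τ s τ′ s′ ≡ above τ τ′
crossIso-above [] [] τ′ s′ _ _ _ = refl
crossIso-above (a ∷ τ) (b ∷ s) τ′ s′ e e′ s≻s′ with Equivalence.to T-∧ s≻s′
... | b≻s′ , s≻s′ =
  cong₂ _∧_ (all-samePosition-below a b τ′ s′ e′ b≻s′) (crossIso-above τ s τ′ s′ (ℕ.suc-injective e) e′ s≻s′)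

crossIso-below : ∀ τ s τ′ s′ → length τ ≡ length s → length τ′ ≡ length s′ → T (below s s′) →
  crossIso τ s τ′ s′ ≡ below τ τ′
crossIso-below [] [] τ′ s′ _ _ _ = refl
crossIso-below (a ∷ τ) (b ∷ s) τ′ s′ e e′ s≺s′ with Equivalence.to T-∧ s≺s′
... | b≺s′ , s≺s′ =
  cong₂ _∧_ (all-samePosition-above a b τ′ s′ e′ b≺s′) (crossIso-below τ s τ′ s′ (ℕ.suc-injective e) e′ s≺s′)

<ᵇ-+ : ∀ k a b → ((k + a) <ᵇ (k + b)) ≡ (a <ᵇ b)
<ᵇ-+ zero a b = refl
<ᵇ-+ (suc k) a b = <ᵇ-+ k a b

orderIso-shiftʳ : ∀ k τ s → orderIso τ (map (k +_) s) ≡ orderIso τ s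
orderIso-shiftʳ k [] [] = refl
orderIso-shiftʳ k [] (_ ∷ _) = refl
orderIso-shiftʳ k (_ ∷ _) [] = refl
orderIso-shiftʳ k (a ∷ τ) (b ∷ s) = cong₂ _∧_ (shift-all τ s) (orderIso-shiftʳ k τ s)
  where
  shift-all : ∀ τ s → all (samePosition a (k + b)) (zip τ (map (k +_) s)) ≡ all (samePosition a b) (zip τ s)
  shift-all [] s = refl
  shift-all (_ ∷ _) [] = refl
  shift-all (c ∷ τ) (d ∷ s) rewrite <ᵇ-+ k b d | <ᵇ-+ k d b = cong (samePosition a b (c , d) ∧_) (shift-all τ s)

orderIso-shiftˡ : ∀ k τ s → orderIso (map (k +_) τ) s ≡ orderIso τ s
orderIso-shiftˡ k [] [] = refl
orderIso-shiftˡ k [] (_ ∷ _) = refl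
orderIso-shiftˡ k (_ ∷ _) [] = refl
orderIso-shiftˡ k (a ∷ τ) (b ∷ s) = cong₂ _∧_ (shift-all τ s) (orderIso-shiftˡ k τ s)
  where
  shift-all : ∀ τ s → all (samePosition (k + a) b) (zip (map (k +_) τ) s) ≡ all (samePosition a b) (zip τ s)
  shift-all [] s = refl
  shift-all (_ ∷ _) [] = refl
  shift-all (c ∷ τ) (d ∷ s) rewrite <ᵇ-+ k a c | <ᵇ-+ k c a = cong (samePosition a b (c , d) ∧_) (shift-all τ s)

⊆-map⁻ : ∀ {A B : Set} (f : A → B) {s} xs → s ⊆ map f xs → ∃ λ s′ → s ≡ map f s′ × s′ ⊆ xs
⊆-map⁻ f [] [] = [] , refl , []
⊆-map⁻ f (x ∷ xs) (refl ∷ p) with ⊆-map⁻ f xs p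
... | s′ , refl , q = x ∷ s′ , refl , refl ∷ q
⊆-map⁻ f (x ∷ xs) (_ ∷ʳ p) with ⊆-map⁻ f xs p
... | s′ , refl , q = s′ , refl , x ∷ʳ q

module _ (k : ℕ) {α τ : List ℕ} where

  contains-shift⁺ : Contains α τ → Contains (map (k +_) α) τ
  contains-shift⁺ c with contains⁻ c
  ... | s , s⊆α , τ≅s = contains⁺ (⊆-map⁺ (k +_) s⊆α) (subst T (sym (orderIso-shiftʳ k τ s)) τ≅s)

  contains-shift⁻ : Contains (map (k +_) α) τ → Contains α τ
  contains-shift⁻ c with contains⁻ c
  ... | s , s⊆α , τ≅s with ⊆-map⁻ (k +_) α s⊆α
  ...   | s′ , refl , s′⊆α = contains⁺ s′⊆α (subst T (orderIso-shiftʳ k τ s′) τ≅s)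

  pattern-shift⁺ : Contains α τ → Contains α (map (k +_) τ)
  pattern-shift⁺ c with contains⁻ c
  ... | s , s⊆α , τ≅s = contains⁺ s⊆α (subst T (sym (orderIso-shiftˡ k τ s)) τ≅s)

  pattern-shift⁻ : Contains α (map (k +_) τ) → Contains α τ
  pattern-shift⁻ c with contains⁻ c
  ... | s , s⊆α , τ≅s = contains⁺ s⊆α (subst T (orderIso-shiftˡ k τ s) τ≅s)

orderIso-take-drop : ∀ k τ s → T (orderIso τ s) →
  T (orderIso (take k τ) (take k s)) × T (orderIso (drop k τ) (drop k s))
orderIso-take-drop k τ s τ≅s with orderIso-++⁻ (take k τ) (take k s) (drop k τ) (drop k s) len
                                   (subst T (cong₂ orderIso (sym (List.take++drop≡id k τ)) (sym (List.take++drop≡id k s))) τ≅s)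
  where
  len = trans (List.length-take k τ) (trans (cong (k ℕ.⊓_) (orderIso-length τ s τ≅s)) (sym (List.length-take k s)))
... | prefix , _ , suffix = prefix , suffix

module _ (k : ℕ) {α τ : List ℕ} where

  contains-take : Contains α τ → Contains α (take k τ)
  contains-take c with contains⁻ c
  ... | s , s⊆α , τ≅s = contains⁺ (⊆-trans (take-⊆ k s) s⊆α) (proj₁ (orderIso-take-drop k τ s τ≅s))

  contains-drop : Contains α τ → Contains α (drop k τ)
  contains-drop c with contains⁻ c
  ... | s , s⊆α , τ≅s = contains⁺ (⊆-trans (drop-⊆ k s) s⊆α) (proj₂ (orderIso-take-drop k τ s τ≅s))

-- Occurrences around the maximum

infix 4 _≻_
_≻_ : List ℕ → List ℕ → Set
xs ≻ ys = ∀ {x y} → x ∈ xs → y ∈ ys → y < x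

above⁺ : ∀ xs ys → xs ≻ ys → T (above xs ys)
above⁺ xs ys xs≻ys = all⁻ _ (All.tabulate λ x∈ → all⁻ _ (All.tabulate λ y∈ → ℕ.<⇒<ᵇ (xs≻ys x∈ y∈)))

above⁻ : ∀ xs ys → T (above xs ys) → xs ≻ ys
above⁻ xs ys xs≻ys {x} {y} x∈ y∈ = ℕ.<ᵇ⇒< y x (All.lookup (all⁺ _ ys (All.lookup (all⁺ _ xs xs≻ys) x∈)) y∈)

below⁺ : ∀ xs ys → ys ≻ xs → T (below xs ys)
below⁺ xs ys ys≻xs = all⁻ _ (All.tabulate λ x∈ → all⁻ _ (All.tabulate λ y∈ → ℕ.<⇒<ᵇ (ys≻xs y∈ x∈)))

below⁻ : ∀ xs ys → T (below xs ys) → ys ≻ xs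
below⁻ xs ys xs≺ys {y} {x} y∈ x∈ = ℕ.<ᵇ⇒< x y (All.lookup (all⁺ _ ys (All.lookup (all⁺ _ xs xs≺ys) x∈)) y∈)

split-length : ∀ (u τ : List ℕ) → length u ≤ length τ → ∃₂ λ τ₁ τ₂ → τ ≡ τ₁ ++ τ₂ × length τ₁ ≡ length u
split-length [] τ _ = [] , τ , refl , refl
split-length (_ ∷ u) (a ∷ τ) (s≤s le) with split-length u τ le
... | τ₁ , τ₂ , refl , e = a ∷ τ₁ , τ₂ , refl , cong suc e

⊆-++⁻ : ∀ {s} (A B : List ℕ) → s ⊆ A ++ B → ∃₂ λ u v → s ≡ u ++ v × u ⊆ A × v ⊆ B
⊆-++⁻ [] B p = [] , _ , refl , [] , p
⊆-++⁻ (x ∷ A) B (refl ∷ p) with ⊆-++⁻ A B p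
... | u , v , refl , u⊆A , v⊆B = x ∷ u , v , refl , refl ∷ u⊆A , v⊆B
⊆-++⁻ (x ∷ A) B (_ ∷ʳ p) with ⊆-++⁻ A B p
... | u , v , refl , u⊆A , v⊆B = u , v , refl , x ∷ʳ u⊆A , v⊆B

length-≤-++ : ∀ (u w : List ℕ) → length u ≤ length (u ++ w)
length-≤-++ u w = subst (length u ≤_) (sym (List.length-++ u)) (ℕ.m≤m+n (length u) (length w))

-- The shape of a 132-avoiding permutation around its maximum m.
record MaxDecomposition (A : List ℕ) (m : ℕ) (B : List ℕ) : Set where
  field
    left≻right : A ≻ B
    m≻left : ∀ {a} → a ∈ A → a < m
    m≻right : ∀ {b} → b ∈ B → b < m

module SplitAtMaximum {A B : List ℕ} {m : ℕ} (d : MaxDecomposition A m B) where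
  open MaxDecomposition d renaming (left≻right to A≻B; m≻left to m≻A; m≻right to m≻B)

  SplitWithoutMax : List ℕ → Set
  SplitWithoutMax τ = ∃₂ λ τ₁ τ₂ → τ ≡ τ₁ ++ τ₂ × T (above τ₁ τ₂) × Contains A τ₁ × Contains B τ₂

  SplitAtMax : List ℕ → Set
  SplitAtMax τ = ∃₂ λ τ₁ τ₂ → ∃ λ t → τ ≡ τ₁ ++ t ∷ τ₂ × T (below τ₁ (t ∷ [])) × T (above (τ₁ ++ t ∷ []) τ₂)
                × Contains A τ₁ × Contains B τ₂

  private
    above-AB : ∀ {u v} → u ⊆ A → v ⊆ B → T (above u v)
    above-AB {u} {v} u⊆A v⊆B = above⁺ u v λ x∈ y∈ → A≻B (lookup u⊆A x∈) (lookup v⊆B y∈)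

    below-m : ∀ {u} → u ⊆ A → T (below u (m ∷ []))
    below-m {u} u⊆A = below⁺ u (m ∷ []) λ { (here refl) x∈ → m≻A (lookup u⊆A x∈) }

    above-Am-B : ∀ {u v} → u ⊆ A → v ⊆ B → T (above (u ++ m ∷ []) v)
    above-Am-B {u} {v} u⊆A v⊆B = above⁺ (u ++ m ∷ []) v λ x∈ y∈ → case ∈-++⁻ u x∈ of λ
      { (inj₁ x∈u) → A≻B (lookup u⊆A x∈u) (lookup v⊆B y∈)
      ; (inj₂ (here refl)) → m≻B (lookup v⊆B y∈) }

  splitWithoutMax⁺ : ∀ {τ} → SplitWithoutMax τ → Contains (A ++ m ∷ B) τ
  splitWithoutMax⁺ (τ₁ , τ₂ , refl , τ₁≻τ₂ , cA , cB) with contains⁻ cA | contains⁻ cB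
  ... | u , u⊆A , τ₁≅u | v , v⊆B , τ₂≅v =
    contains⁺ (⊆-++⁺ u⊆A (m ∷ʳ v⊆B)) (orderIso-++⁺ τ₁ u τ₂ v τ₁≅u (subst T (sym cross) τ₁≻τ₂) τ₂≅v)
    where
    cross = crossIso-above τ₁ u τ₂ v (orderIso-length τ₁ u τ₁≅u) (orderIso-length τ₂ v τ₂≅v) (above-AB u⊆A v⊆B)

  splitAtMax⁺ : ∀ {τ} → SplitAtMax τ → Contains (A ++ m ∷ B) τ
  splitAtMax⁺ (τ₁ , τ₂ , t , refl , τ₁≺t , τ₁t≻τ₂ , cA , cB) with contains⁻ cA | contains⁻ cB
  ... | u , u⊆A , τ₁≅u | v , v⊆B , τ₂≅v =
    subst₂ Contains (List.++-assoc A (m ∷ []) B) (List.++-assoc τ₁ (t ∷ []) τ₂)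
      (contains⁺ (⊆-++⁺ (⊆-++⁺ u⊆A (refl ∷ [])) v⊆B)
                 (orderIso-++⁺ (τ₁ ++ t ∷ []) (u ++ m ∷ []) τ₂ v τ₁t≅um (subst T (sym cross) τ₁t≻τ₂) τ₂≅v))
    where
    len₁ = orderIso-length τ₁ u τ₁≅u
    τ₁t≅um : T (orderIso (τ₁ ++ t ∷ []) (u ++ m ∷ []))
    τ₁t≅um = orderIso-++⁺ τ₁ u (t ∷ []) (m ∷ []) τ₁≅u
               (subst T (sym (crossIso-below τ₁ u (t ∷ []) (m ∷ []) len₁ refl (below-m u⊆A))) τ₁≺t) _
    cross = crossIso-above (τ₁ ++ t ∷ []) (u ++ m ∷ []) τ₂ v (orderIso-length (τ₁ ++ t ∷ []) (u ++ m ∷ []) τ₁t≅um)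
                           (orderIso-length τ₂ v τ₂≅v)
                           (above-Am-B u⊆A v⊆B)

  private
    split-τ : ∀ τ u w → T (orderIso τ (u ++ w)) → ∃₂ λ τ₁ τ₂ → τ ≡ τ₁ ++ τ₂ × length τ₁ ≡ length u
    split-τ τ u w τ≅uw = split-length u τ (subst (length u ≤_) (sym (orderIso-length τ (u ++ w) τ≅uw)) (length-≤-++ u w))

    orderIso-singleton : ∀ r → T (orderIso r (m ∷ [])) → ∃ λ t → r ≡ t ∷ []
    orderIso-singleton (t ∷ []) _ = t , refl

    splitWithoutMax⁻ : ∀ τ u w → u ⊆ A → w ⊆ B → T (orderIso τ (u ++ w)) → SplitWithoutMax τ
    splitWithoutMax⁻ τ u w u⊆A w⊆B τ≅uw with split-τ τ u w τ≅uw
    ... | τ₁ , τ₂ , refl , len₁ with orderIso-++⁻ τ₁ u τ₂ w len₁ τ≅uw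
    ...   | τ₁≅u , cross , τ₂≅w =
      τ₁ , τ₂ , refl , subst T (crossIso-above τ₁ u τ₂ w len₁ (orderIso-length τ₂ w τ₂≅w) (above-AB u⊆A w⊆B)) cross
      , contains⁺ u⊆A τ₁≅u , contains⁺ w⊆B τ₂≅w

    splitAtMax⁻ : ∀ τ u v → u ⊆ A → v ⊆ B → T (orderIso τ ((u ++ m ∷ []) ++ v)) → SplitAtMax τ
    splitAtMax⁻ τ u v u⊆A v⊆B τ≅umv with split-τ τ (u ++ m ∷ []) v τ≅umv
    ... | τ₁t , τ₂ , refl , lenₘ with orderIso-++⁻ τ₁t (u ++ m ∷ []) τ₂ v lenₘ τ≅umv
    ...   | τ₁t≅um , crossₘ , τ₂≅v with split-τ τ₁t u (m ∷ []) τ₁t≅um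
    ...     | τ₁ , r , refl , len₁ with orderIso-++⁻ τ₁ u r (m ∷ []) len₁ τ₁t≅um
    ...       | τ₁≅u , cross₁ , r≅m with orderIso-singleton r r≅m
    ...         | t , refl =
      τ₁ , τ₂ , t , List.++-assoc τ₁ (t ∷ []) τ₂
      , subst T (crossIso-below τ₁ u (t ∷ []) (m ∷ []) len₁ refl (below-m u⊆A)) cross₁
      , subst T (crossIso-above (τ₁ ++ t ∷ []) (u ++ m ∷ []) τ₂ v lenₘ (orderIso-length τ₂ v τ₂≅v) (above-Am-B u⊆A v⊆B))
                crossₘ
      , contains⁺ u⊆A τ₁≅u , contains⁺ v⊆B τ₂≅v

  split⁻ : ∀ {τ} → Contains (A ++ m ∷ B) τ → SplitWithoutMax τ ⊎ SplitAtMax τ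
  split⁻ {τ} c with contains⁻ c
  ... | s , s⊆ , τ≅s with ⊆-++⁻ A (m ∷ B) s⊆
  ...   | u , w , refl , u⊆A , (_ ∷ʳ w⊆B) = inj₁ (splitWithoutMax⁻ τ u w u⊆A w⊆B τ≅s)
  ...   | u , _ ∷ v , refl , u⊆A , (refl ∷ v⊆B) =
    inj₂ (splitAtMax⁻ τ u v u⊆A v⊆B (subst (T ∘ orderIso τ) (sym (List.++-assoc u (m ∷ []) v)) τ≅s))

-- Layered patterns

run : ℕ → ℕ → List ℕ
run S zero = []
run S (suc c) = suc S ∷ run (suc S) c

-- The pattern [k, m₁, m₂] of the paper is layered (k - m₁ ∷ m₁ - m₂ ∷ m₂ ∷ []).
layered : List ℕ → List ℕ
layered [] = []
layered (c ∷ cs) = run (sum cs) c ++ layered cs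

increasing : ℕ → List ℕ
increasing = run 0

run-∈ : ∀ {S c y} → y ∈ run S c → S < y × y ≤ S + c
run-∈ {S} {suc c} (here refl) = ℕ.≤-refl , subst (suc S ≤_) (sym (ℕ.+-suc S c)) (s≤s (ℕ.m≤m+n S c))
run-∈ {S} {suc c} {y} (there y∈) with run-∈ {suc S} {c} y∈
... | S<y , y≤ = ℕ.<-trans (ℕ.n<1+n S) S<y , subst (y ≤_) (sym (ℕ.+-suc S c)) y≤

layered-∈ : ∀ {cs y} → y ∈ layered cs → 0 < y × y ≤ sum cs
layered-∈ {c ∷ cs} {y} y∈ with ∈-++⁻ (run (sum cs) c) y∈
... | inj₁ y∈run = ℕ.≤-<-trans z≤n (proj₁ (run-∈ y∈run)) , subst (y ≤_) (ℕ.+-comm (sum cs) c) (proj₂ (run-∈ y∈run))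
... | inj₂ y∈rest = proj₁ (layered-∈ {cs} y∈rest) , ℕ.≤-trans (proj₂ (layered-∈ {cs} y∈rest)) (ℕ.m≤n+m (sum cs) c)

run-shift : ∀ k S c → map (k +_) (run S c) ≡ run (k + S) c
run-shift k S zero = refl
run-shift k S (suc c) = cong₂ _∷_ (ℕ.+-suc k S) (trans (run-shift k (suc S) c) (cong (λ S′ → run S′ c) (ℕ.+-suc k S)))

run-from : ∀ S c → run S c ≡ map (S +_) (increasing c)
run-from S c = sym (trans (run-shift S 0 c) (cong (λ S′ → run S′ c) (ℕ.+-identityʳ S)))

run-snoc : ∀ S c → run S (suc c) ≡ run S c ++ suc (S + c) ∷ []
run-snoc S zero = cong (λ n → suc n ∷ []) (sym (ℕ.+-identityʳ S))
run-snoc S (suc c) = cong (suc S ∷_) (trans (run-snoc (suc S) c) (cong (λ n → run (suc S) c ++ suc n ∷ []) (sym (ℕ.+-suc S c))))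

take-run : ∀ j S → take j (run S (suc j)) ≡ run S j
take-run zero S = refl
take-run (suc j) S = cong (suc S ∷_) (take-run j (suc S))

layered-[_] : ∀ c → layered (c ∷ []) ≡ increasing c
layered-[ c ] = List.++-identityʳ (run 0 c)

sum-drop-take : ∀ i cs → sum (drop i cs) + sum (take i cs) ≡ sum cs
sum-drop-take i cs = trans (ℕ.+-comm (sum (drop i cs)) (sum (take i cs)))
                           (trans (sym (sum-++ (take i cs) (drop i cs))) (cong sum (List.take++drop≡id i cs)))

layered-take-drop : ∀ i cs → layered cs ≡ map (sum (drop i cs) +_) (layered (take i cs)) ++ layered (drop i cs)
layered-take-drop zero cs = refl
layered-take-drop (suc i) [] = refl
layered-take-drop (suc i) (c ∷ cs) = begin
  run (sum cs) c ++ layered cs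
    ≡⟨ cong (run (sum cs) c ++_) (layered-take-drop i cs) ⟩
  run (sum cs) c ++ map (D +_) (layered (take i cs)) ++ layered (drop i cs)
    ≡⟨ cong (λ S → run S c ++ map (D +_) (layered (take i cs)) ++ layered (drop i cs)) (sym (sum-drop-take i cs)) ⟩
  run (D + sum (take i cs)) c ++ map (D +_) (layered (take i cs)) ++ layered (drop i cs)
    ≡⟨ cong (_++ map (D +_) (layered (take i cs)) ++ layered (drop i cs)) (sym (run-shift D (sum (take i cs)) c)) ⟩
  map (D +_) (run (sum (take i cs)) c) ++ map (D +_) (layered (take i cs)) ++ layered (drop i cs)
    ≡⟨ sym (List.++-assoc (map (D +_) (run (sum (take i cs)) c)) _ _) ⟩
  (map (D +_) (run (sum (take i cs)) c) ++ map (D +_) (layered (take i cs))) ++ layered (drop i cs)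
    ≡⟨ cong (_++ layered (drop i cs)) (sym (List.map-++ (D +_) (run (sum (take i cs)) c) (layered (take i cs)))) ⟩
  map (D +_) (layered (take (suc i) (c ∷ cs))) ++ layered (drop (suc i) (c ∷ cs)) ∎
  where
  open ≡-Reasoning
  D = sum (drop i cs)

layered-split-above : ∀ cs τ₁ τ₂ → layered cs ≡ τ₁ ++ τ₂ → τ₁ ≻ τ₂ →
  ∃ λ i → τ₁ ≡ map (sum (drop i cs) +_) (layered (take i cs)) × τ₂ ≡ layered (drop i cs)
layered-split-above [] [] [] _ _ = 0 , refl , refl
layered-split-above (c ∷ cs) τ₁ τ₂ e τ₁≻τ₂ with ++-≡-++ (run (sum cs) c) (layered cs) τ₁ τ₂ e
... | inj₁ (r , refl , q) with layered-split-above cs r τ₂ q (λ x∈ → τ₁≻τ₂ (∈-++⁺ʳ (run (sum cs) c) x∈))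
...   | i , refl , refl =
  suc i , sym (trans (List.map-++ (D +_) (run (sum (take i cs)) c) (layered (take i cs)))
                     (cong (_++ _) (trans (run-shift D (sum (take i cs)) c) (cong (λ S → run S c) (sum-drop-take i cs)))))
  , refl
  where D = sum (drop i cs)
layered-split-above (c ∷ cs) [] τ₂ e τ₁≻τ₂ | inj₂ (r , p , refl) = 0 , refl , cong (_++ layered cs) (sym p)
layered-split-above (c ∷ cs) τ₁@(_ ∷ _) τ₂ e τ₁≻τ₂ | inj₂ ([] , p , refl) =
  1 , sym (trans (cong (map (sum cs +_)) (layered-[ c ])) (trans (sym (run-from (sum cs) c)) (trans p (List.++-identityʳ τ₁)))) , refl
layered-split-above (suc c ∷ cs) (x ∷ τ₁) τ₂ e τ₁≻τ₂ | inj₂ (y ∷ r , p , refl) with List.∷-injective p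
... | refl , p′ =
  ⊥-elim (ℕ.<-asym (τ₁≻τ₂ (here refl) (here refl)) (proj₁ (run-∈ (subst (y ∈_) (sym p′) (∈-++⁺ʳ τ₁ (here refl))))))

layered-split-max : ∀ c cs τ₁ t τ₂ → layered (suc c ∷ cs) ≡ τ₁ ++ t ∷ τ₂ →
  (t ∷ []) ≻ τ₁ → (τ₁ ++ t ∷ []) ≻ τ₂ →
  τ₁ ≡ run (sum cs) c × τ₂ ≡ layered cs
layered-split-max c cs τ₁ t τ₂ e t≻τ₁ τ₁t≻τ₂
  with ++-∷-injective (run S c) (layered cs) τ₁ τ₂ M∉run M∉τ₁
                      (trans (sym split) (trans e (cong (λ t → τ₁ ++ t ∷ τ₂) t≡M)))
  where
  S = sum cs
  M = suc (S + c)
  split : layered (suc c ∷ cs) ≡ run S c ++ M ∷ layered cs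
  split = trans (cong (_++ layered cs) (run-snoc S c)) (List.++-assoc (run S c) (M ∷ []) (layered cs))
  t≤M : t ≤ M
  t≤M = subst (t ≤_) (cong suc (ℕ.+-comm c S))
              (proj₂ (layered-∈ {suc c ∷ cs} (subst (t ∈_) (sym e) (∈-++⁺ʳ τ₁ (here refl)))))
  t≡M : t ≡ M
  t≡M with ∈-++⁻ τ₁ (subst (M ∈_) (trans (sym split) e) (∈-++⁺ʳ (run S c) (here refl)))
  ... | inj₁ M∈τ₁ = ⊥-elim (ℕ.<⇒≱ (t≻τ₁ (here refl) M∈τ₁) t≤M)
  ... | inj₂ (here M≡t) = sym M≡t
  ... | inj₂ (there M∈τ₂) = ⊥-elim (ℕ.<⇒≱ (τ₁t≻τ₂ (∈-++⁺ʳ τ₁ (here refl)) M∈τ₂) t≤M)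
  M∉run : M ∉ run S c
  M∉run M∈ = ℕ.<-irrefl refl (s≤s (proj₂ (run-∈ M∈)))
  M∉τ₁ : M ∉ τ₁
  M∉τ₁ M∈ = ℕ.<-irrefl (sym t≡M) (t≻τ₁ (here refl) M∈)
... | p , q = sym p , sym q

take-++-length : ∀ (X Y : List ℕ) → take (length X) (X ++ Y) ≡ X
take-++-length [] Y = refl
take-++-length (x ∷ X) Y = cong (x ∷_) (take-++-length X Y)

drop-++-length : ∀ (X Y : List ℕ) → drop (length X) (X ++ Y) ≡ Y
drop-++-length [] Y = refl
drop-++-length (x ∷ X) Y = drop-++-length X Y

module _ {α : List ℕ} (i : ℕ) (cs : List ℕ) where
  private
    D = sum (drop i cs)
    prefix = map (D +_) (layered (take i cs))

  contains-layered-take : Contains α (layered cs) → Contains α (layered (take i cs))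
  contains-layered-take c = pattern-shift⁻ D (subst (Contains α) (take-++-length prefix _)
                              (contains-take (length prefix) (subst (Contains α) (layered-take-drop i cs) c)))

  contains-layered-drop : Contains α (layered cs) → Contains α (layered (drop i cs))
  contains-layered-drop c = subst (Contains α) (drop-++-length prefix _)
                              (contains-drop (length prefix) (subst (Contains α) (layered-take-drop i cs) c))

contains-increasing-pred : ∀ {α} j → Contains α (increasing (suc j)) → Contains α (increasing j)
contains-increasing-pred {α} j c = subst (Contains α) (take-run j 0) (contains-take j c)

module LayeredAtMaximum {A B : List ℕ} {m : ℕ} (d : MaxDecomposition A m B) where
  open SplitAtMaximum d

  layered⁻ : ∀ c cs → Contains (A ++ m ∷ B) (layered (suc c ∷ cs)) →
    (∃ λ i → Contains A (layered (take i (suc c ∷ cs))) × Contains B (layered (drop i (suc c ∷ cs))))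
    ⊎ (Contains A (increasing c) × Contains B (layered cs))
  layered⁻ c cs occurrence with split⁻ occurrence
  ... | inj₁ (τ₁ , τ₂ , e , τ₁≻τ₂ , cA , cB)
    with layered-split-above (suc c ∷ cs) τ₁ τ₂ e (above⁻ τ₁ τ₂ τ₁≻τ₂)
  ...   | i , refl , refl = inj₁ (i , pattern-shift⁻ (sum (drop i (suc c ∷ cs))) cA , cB)
  layered⁻ c cs occurrence | inj₂ (τ₁ , τ₂ , t , e , τ₁≺t , τ₁t≻τ₂ , cA , cB)
    with layered-split-max c cs τ₁ t τ₂ e (below⁻ τ₁ (t ∷ []) τ₁≺t) (above⁻ (τ₁ ++ t ∷ []) τ₂ τ₁t≻τ₂)
  ... | refl , refl = inj₂ (pattern-shift⁻ (sum cs) (subst (Contains A) (run-from (sum cs) c) cA) , cB)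

  layered⁺-split : ∀ i cs → Contains A (layered (take i cs)) → Contains B (layered (drop i cs)) →
    Contains (A ++ m ∷ B) (layered cs)
  layered⁺-split i cs cA cB = subst (Contains (A ++ m ∷ B)) (sym (layered-take-drop i cs))
    (splitWithoutMax⁺ (_ , _ , refl , above⁺ _ _ prefix≻suffix , pattern-shift⁺ D cA , cB))
    where
    D = sum (drop i cs)
    prefix≻suffix : map (D +_) (layered (take i cs)) ≻ layered (drop i cs)
    prefix≻suffix x∈ y∈ with ∈-map⁻ (D +_) x∈
    ... | x , x∈′ , refl = ℕ.≤-<-trans (proj₂ (layered-∈ {drop i cs} y∈))
                             (subst (_< D + x) (ℕ.+-identityʳ D) (ℕ.+-monoʳ-< D (proj₁ (layered-∈ {take i cs} x∈′))))

  layered⁺-max : ∀ c cs → Contains A (increasing c) → Contains B (layered cs) → Contains (A ++ m ∷ B) (layered (suc c ∷ cs))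
  layered⁺-max c cs cA cB = subst (Contains (A ++ m ∷ B)) (sym split)
    (splitAtMax⁺ (run S c , layered cs , M , refl , below⁺ _ _ M≻run , above⁺ _ _ runM≻rest
                 , subst (Contains A) (sym (run-from S c)) (pattern-shift⁺ S cA) , cB))
    where
    S = sum cs
    M = suc (S + c)
    split : layered (suc c ∷ cs) ≡ run S c ++ M ∷ layered cs
    split = trans (cong (_++ layered cs) (run-snoc S c)) (List.++-assoc (run S c) (M ∷ []) (layered cs))
    M≻run : (M ∷ []) ≻ run S c
    M≻run (here refl) x∈ = s≤s (proj₂ (run-∈ x∈))
    runM≻rest : (run S c ++ M ∷ []) ≻ layered cs
    runM≻rest x∈ y∈ = ℕ.≤-<-trans (proj₂ (layered-∈ {cs} y∈)) (S<x x∈)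
      where
      S<x : ∀ {x} → x ∈ run S c ++ M ∷ [] → S < x
      S<x x∈ with ∈-++⁻ (run S c) x∈
      ... | inj₁ x∈run = proj₁ (run-∈ x∈run)
      ... | inj₂ (here refl) = s≤s (ℕ.m≤m+n S c)

  private
    α = A ++ m ∷ B

    contains-≡ : ∀ {τ} f → (Contains α τ → T f) → (T f → Contains α τ) → contains α τ ≡ f
    contains-≡ f to from = T-ext (to ∘ mkContains) (Contains.holds ∘ from)

    ∨ˡ : ∀ {x y} → T x → T (x ∨ y)
    ∨ˡ p = Equivalence.from T-∨ (inj₁ p)

    ∨ʳ : ∀ {x y} → T y → T (x ∨ y)
    ∨ʳ {x} p = Equivalence.from (T-∨ {x}) (inj₂ p)

    ∨-elim : ∀ {x y} {C : Set} → (T x → C) → (T y → C) → T (x ∨ y) → C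
    ∨-elim f g p = [ f , g ] (Equivalence.to T-∨ p)

    ∧-intro : ∀ {τ τ′} → Contains A τ → Contains B τ′ → T (contains A τ ∧ contains B τ′)
    ∧-intro (mkContains p) (mkContains q) = Equivalence.from T-∧ (p , q)

    ∧-elim : ∀ {τ τ′} → T (contains A τ ∧ contains B τ′) → Contains A τ × Contains B τ′
    ∧-elim p = let (q , r) = Equivalence.to T-∧ p in mkContains q , mkContains r

  contains-increasing : ∀ j → contains α (increasing (suc j)) ≡ contains A (increasing j) ∨ contains B (increasing (suc j))
  contains-increasing j = contains-≡ _ to from
    where
    to : Contains α (increasing (suc j)) → T (contains A (increasing j) ∨ contains B (increasing (suc j)))
    to c with layered⁻ j [] (subst (Contains α) (sym layered-[ suc j ]) c)
    ... | inj₁ (0 , _ , cB) = ∨ʳ (Contains.holds (subst (Contains B) layered-[ suc j ] cB))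
    ... | inj₁ (1 , cA , _) = ∨ˡ (Contains.holds (contains-increasing-pred j (subst (Contains A) layered-[ suc j ] cA)))
    ... | inj₁ (suc (suc _) , cA , _) = ∨ˡ (Contains.holds (contains-increasing-pred j (subst (Contains A) layered-[ suc j ] cA)))
    ... | inj₂ (cA , _) = ∨ˡ (Contains.holds cA)
    from : T (contains A (increasing j) ∨ contains B (increasing (suc j))) → Contains α (increasing (suc j))
    from = ∨-elim (λ a → subst (Contains α) layered-[ suc j ] (layered⁺-max j [] (mkContains a) (contains-[] B)))
                  (λ b → subst (Contains α) layered-[ suc j ]
                           (layered⁺-split 0 (suc j ∷ []) (contains-[] A) (subst (Contains B) (sym layered-[ suc j ]) (mkContains b))))

  contains-layered₂ : ∀ a b → contains α (layered (suc a ∷ b ∷ [])) ≡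
    (contains B (layered (suc a ∷ b ∷ [])) ∨ contains A (layered (suc a ∷ b ∷ [])))
    ∨ (contains A (increasing a) ∧ contains B (increasing b))
  contains-layered₂ a b = contains-≡ ((b₁ ∨ a₁) ∨ (a₀ ∧ b₀)) to from
    where
    cs = suc a ∷ b ∷ []
    a₀ = contains A (increasing a)
    a₁ = contains A (layered cs)
    b₀ = contains B (increasing b)
    b₁ = contains B (layered cs)
    to : Contains α (layered cs) → T ((b₁ ∨ a₁) ∨ (a₀ ∧ b₀))
    to c with layered⁻ a (b ∷ []) c
    ... | inj₁ (0 , _ , cB) = ∨ˡ {b₁ ∨ a₁} (∨ˡ {b₁} {a₁} (Contains.holds cB))
    ... | inj₁ (1 , cA , cB) = ∨ʳ {b₁ ∨ a₁} (∧-intro (contains-increasing-pred a (subst (Contains A) layered-[ suc a ] cA))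
                                                      (subst (Contains B) layered-[ b ] cB))
    ... | inj₁ (2 , cA , _) = ∨ˡ {b₁ ∨ a₁} (∨ʳ {b₁} (Contains.holds cA))
    ... | inj₁ (suc (suc (suc _)) , cA , _) = ∨ˡ {b₁ ∨ a₁} (∨ʳ {b₁} (Contains.holds cA))
    ... | inj₂ (cA , cB) = ∨ʳ {b₁ ∨ a₁} (∧-intro cA (subst (Contains B) layered-[ b ] cB))
    from : T ((b₁ ∨ a₁) ∨ (a₀ ∧ b₀)) → Contains α (layered cs)
    from = ∨-elim {b₁ ∨ a₁}
             (∨-elim {b₁} (λ b → layered⁺-split 0 cs (contains-[] A) (mkContains b))
                          (λ a → layered⁺-split 2 cs (mkContains a) (contains-[] B)))
             (λ p → let (cA , cB) = ∧-elim p in layered⁺-max a (b ∷ []) cA (subst (Contains B) (sym layered-[ b ]) cB))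

  contains-layered₃ : ∀ a b g → contains α (layered (suc a ∷ b ∷ g ∷ [])) ≡
    (contains B (layered (suc a ∷ b ∷ g ∷ [])) ∨ contains A (layered (suc a ∷ b ∷ g ∷ [])))
    ∨ ((contains A (layered (suc a ∷ b ∷ [])) ∧ contains B (increasing g))
       ∨ (contains A (increasing a) ∧ contains B (layered (b ∷ g ∷ []))))
  contains-layered₃ a b g = contains-≡ ((b₂ ∨ a₂) ∨ ((a₁ ∧ b₀) ∨ (a₀ ∧ b₁))) to from
    where
    cs = suc a ∷ b ∷ g ∷ []
    a₀ = contains A (increasing a)
    a₁ = contains A (layered (suc a ∷ b ∷ []))
    a₂ = contains A (layered cs)
    b₀ = contains B (increasing g)
    b₁ = contains B (layered (b ∷ g ∷ []))
    b₂ = contains B (layered cs)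
    to : Contains α (layered cs) → T ((b₂ ∨ a₂) ∨ ((a₁ ∧ b₀) ∨ (a₀ ∧ b₁)))
    to c with layered⁻ a (b ∷ g ∷ []) c
    ... | inj₁ (0 , _ , cB) = ∨ˡ {b₂ ∨ a₂} (∨ˡ {b₂} {a₂} (Contains.holds cB))
    ... | inj₁ (1 , cA , cB) =
      ∨ʳ {b₂ ∨ a₂} (∨ʳ {a₁ ∧ b₀} (∧-intro (contains-increasing-pred a (subst (Contains A) layered-[ suc a ] cA)) cB))
    ... | inj₁ (2 , cA , cB) = ∨ʳ {b₂ ∨ a₂} (∨ˡ {a₁ ∧ b₀} {a₀ ∧ b₁} (∧-intro cA (subst (Contains B) layered-[ g ] cB)))
    ... | inj₁ (3 , cA , _) = ∨ˡ {b₂ ∨ a₂} (∨ʳ {b₂} (Contains.holds cA))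
    ... | inj₁ (suc (suc (suc (suc _))) , cA , _) = ∨ˡ {b₂ ∨ a₂} (∨ʳ {b₂} (Contains.holds cA))
    ... | inj₂ (cA , cB) = ∨ʳ {b₂ ∨ a₂} (∨ʳ {a₁ ∧ b₀} (∧-intro cA cB))
    from : T ((b₂ ∨ a₂) ∨ ((a₁ ∧ b₀) ∨ (a₀ ∧ b₁))) → Contains α (layered cs)
    from = ∨-elim {b₂ ∨ a₂}
             (∨-elim {b₂} (λ b → layered⁺-split 0 cs (contains-[] A) (mkContains b))
                          (λ a → layered⁺-split 3 cs (mkContains a) (contains-[] B)))
             (∨-elim {a₁ ∧ b₀}
               (λ p → let (cA , cB) = ∧-elim p in layered⁺-split 2 cs cA (subst (Contains B) (sym layered-[ g ]) cB))
               (λ p → let (cA , cB) = ∧-elim p in layered⁺-max a (b ∷ g ∷ []) cA cB))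

∈-concatMap-find : ∀ {A B : Set} (f : A → List B) xs {y} → y ∈ concatMap f xs → ∃ λ x → x ∈ xs × y ∈ f x
∈-concatMap-find f xs y∈ = find (∈-concatMap⁻ f {xs = xs} y∈)

∈-concatMap-intro : ∀ {A B : Set} (f : A → List B) {xs x y} → x ∈ xs → y ∈ f x → y ∈ concatMap f xs
∈-concatMap-intro f x∈ y∈ = ∈-concatMap⁺ f (lose x∈ y∈)

Unique-concatMap : ∀ {A B : Set} (f : A → List B) xs → Unique xs → (∀ {x} → x ∈ xs → Unique (f x)) →
  (∀ {x x′ y} → x ∈ xs → x′ ∈ xs → y ∈ f x → y ∈ f x′ → x ≡ x′) → Unique (concatMap f xs)
Unique-concatMap f [] _ _ _ = []
Unique-concatMap f (x ∷ xs) (x∉xs ∷ u) uf disjoint =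
  Unique.++⁺ (uf (here refl)) (Unique-concatMap f xs u (uf ∘ there) (λ i j → disjoint (there i) (there j)))
    λ { (y∈fx , y∈rest) → let (x′ , x′∈ , y∈fx′) = ∈-concatMap-find f xs y∈rest in
                           All.lookup x∉xs x′∈ (disjoint (here refl) (there x′∈) y∈fx y∈fx′) }

∈-insertions⁻ : ∀ {x α} (ys : List ℕ) → α ∈ insertions x ys → ∃₂ λ u v → ys ≡ u ++ v × α ≡ u ++ x ∷ v
∈-insertions⁻ [] (here refl) = [] , [] , refl , refl
∈-insertions⁻ (y ∷ ys) (here refl) = [] , y ∷ ys , refl , refl
∈-insertions⁻ (y ∷ ys) (there α∈) with ∈-map⁻ (y ∷_) α∈
... | β , β∈ , refl with ∈-insertions⁻ ys β∈
...   | u , v , refl , refl = y ∷ u , v , refl , refl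

∈-insertions⁺ : ∀ {x} (u v : List ℕ) → u ++ x ∷ v ∈ insertions x (u ++ v)
∈-insertions⁺ [] [] = here refl
∈-insertions⁺ [] (y ∷ v) = here refl
∈-insertions⁺ (y ∷ u) v = there (∈-map⁺ (y ∷_) (∈-insertions⁺ u v))

Unique-insertions : ∀ x (ys : List ℕ) → x ∉ ys → Unique (insertions x ys)
Unique-insertions x [] _ = [] ∷ []
Unique-insertions x (y ∷ ys) x∉ =
  All.tabulate (λ α∈ e → let (β , _ , α≡) = ∈-map⁻ (y ∷_) α∈ in x∉ (here (List.∷-injectiveˡ (trans e α≡))))
  ∷ Unique.map⁺ List.∷-injectiveʳ (Unique-insertions x ys (x∉ ∘ there))

∈-perms⁻ : ∀ {α} (xs : List ℕ) → α ∈ perms xs → α ↭ xs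
∈-perms⁻ [] (here refl) = ↭-refl
∈-perms⁻ (x ∷ xs) α∈ with ∈-concatMap-find (insertions x) (perms xs) α∈
... | β , β∈ , α∈′ with ∈-insertions⁻ β α∈′
...   | u , v , refl , refl = ↭-trans (↭-shift x u v) (↭-prep x (∈-perms⁻ xs β∈))

∈-perms⁺ : ∀ {α} (xs : List ℕ) → α ↭ xs → α ∈ perms xs
∈-perms⁺ [] p with ↭-empty-inv p
... | refl = here refl
∈-perms⁺ (x ∷ xs) p with ∈-∃++ (∈-resp-↭ (↭-sym p) (here refl))
... | u , v , refl = ∈-concatMap-intro (insertions x) (∈-perms⁺ xs (drop-mid u [] p)) (∈-insertions⁺ u v)

Unique-perms : ∀ (xs : List ℕ) → Unique xs → Unique (perms xs)
Unique-perms [] _ = [] ∷ []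
Unique-perms (x ∷ xs) (x∉xs ∷ u) =
  Unique-concatMap (insertions x) (perms xs) (Unique-perms xs u) (λ β∈ → Unique-insertions x _ (x∉ β∈)) disjoint
  where
  x∉ : ∀ {β} → β ∈ perms xs → x ∉ β
  x∉ β∈ x∈β = All.lookup x∉xs (∈-resp-↭ (∈-perms⁻ xs β∈) x∈β) refl
  disjoint : ∀ {β β′ α} → β ∈ perms xs → β′ ∈ perms xs → α ∈ insertions x β → α ∈ insertions x β′ → β ≡ β′
  disjoint {β} {β′} β∈ β′∈ α∈ α∈′ with ∈-insertions⁻ β α∈ | ∈-insertions⁻ β′ α∈′
  ... | u , v , refl , refl | u′ , v′ , refl , e
    with ++-∷-injective u v u′ v′ (λ x∈ → x∉ β∈ (∈-++⁺ˡ x∈)) (λ x∈ → x∉ β′∈ (∈-++⁺ˡ x∈)) e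
  ...   | refl , refl = refl

Unique-Sym : ∀ n → Unique (Sym n)
Unique-Sym n = Unique-perms (upTo n) (Unique.upTo⁺ n)

-- The 132-avoiders of length n + 1 are exactly the glue n k A B with A and B 132-avoiders of lengths
-- n - k and k.
glue : ℕ → ℕ → List ℕ → List ℕ → List ℕ
glue n k A B = map (k +_) A ++ n ∷ B

-- avoiders′ fuel n lists the 132-avoiding permutations of length n whenever n ≤ fuel; the fuel only
-- makes the recursion through the two smaller lengths j and n - j structural.
avoiders′ : ℕ → ℕ → List (List ℕ)
avoiders′ _ zero = [] ∷ []
avoiders′ zero (suc n) = []
avoiders′ (suc fuel) (suc n) =
  concatMap (λ j → concatMap (λ A → map (glue n (n ∸ j) A) (avoiders′ fuel (n ∸ j))) (avoiders′ fuel j)) (upTo (suc n))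

avoiders : ℕ → List (List ℕ)
avoiders n = avoiders′ n n

module _ {fuel n : ℕ} where

  ∈-avoiders′⁻ : ∀ {α} → α ∈ avoiders′ (suc fuel) (suc n) →
    ∃ λ j → ∃₂ λ A B → j < suc n × A ∈ avoiders′ fuel j × B ∈ avoiders′ fuel (n ∸ j) × α ≡ glue n (n ∸ j) A B
  ∈-avoiders′⁻ α∈ with ∈-concatMap-find _ (upTo (suc n)) α∈
  ... | j , j∈ , α∈′ with ∈-concatMap-find _ (avoiders′ fuel j) α∈′
  ...   | A , A∈ , α∈″ with ∈-map⁻ (glue n (n ∸ j) A) α∈″
  ...     | B , B∈ , refl = j , A , B , ∈-upTo⁻ j∈ , A∈ , B∈ , refl

  ∈-avoiders′⁺ : ∀ {j A B} → j < suc n → A ∈ avoiders′ fuel j → B ∈ avoiders′ fuel (n ∸ j) →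
    glue n (n ∸ j) A B ∈ avoiders′ (suc fuel) (suc n)
  ∈-avoiders′⁺ {j} {A} j< A∈ B∈ =
    ∈-concatMap-intro _ (∈-upTo⁺ j<) (∈-concatMap-intro _ A∈ (∈-map⁺ (glue n (n ∸ j) A) B∈))

shift-< : ∀ {n j a} → j < suc n → a < j → n ∸ j + a < n
shift-< {n} {j} {a} j< a<j =
  subst (n ∸ j + a <_) (trans (ℕ.+-comm (n ∸ j) j) (ℕ.m+[n∸m]≡n (ℕ.≤-pred j<))) (ℕ.+-monoʳ-< (n ∸ j) a<j)

avoiders′-length : ∀ fuel n {α} → α ∈ avoiders′ fuel n → length α ≡ n
avoiders′-length fuel zero (here refl) = refl
avoiders′-length (suc fuel) (suc n) α∈ with ∈-avoiders′⁻ {fuel} {n} α∈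
... | j , A , B , j< , A∈ , B∈ , refl = begin
  length (map (n ∸ j +_) A ++ n ∷ B)     ≡⟨ List.length-++ (map (n ∸ j +_) A) ⟩
  length (map (n ∸ j +_) A) + suc (length B) ≡⟨ cong₂ (λ a b → a + suc b) (trans (List.length-map _ A) (avoiders′-length fuel j A∈))
                                                                         (avoiders′-length fuel (n ∸ j) B∈) ⟩
  j + suc (n ∸ j)                        ≡⟨ ℕ.+-suc j (n ∸ j) ⟩
  suc (j + (n ∸ j))                      ≡⟨ cong suc (ℕ.m+[n∸m]≡n (ℕ.≤-pred j<)) ⟩
  suc n                                  ∎
  where open ≡-Reasoning

avoiders′-bound : ∀ fuel n {α y} → α ∈ avoiders′ fuel n → y ∈ α → y < n
avoiders′-bound fuel zero (here refl) ()
avoiders′-bound (suc fuel) (suc n) α∈ y∈ with ∈-avoiders′⁻ {fuel} {n} α∈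
... | j , A , B , j< , A∈ , B∈ , refl with ∈-++⁻ (map (n ∸ j +_) A) y∈
...   | inj₁ y∈A with ∈-map⁻ (n ∸ j +_) y∈A
...     | a , a∈ , refl = ℕ.m<n⇒m<1+n (shift-< j< (avoiders′-bound fuel j A∈ a∈))
avoiders′-bound (suc fuel) (suc n) α∈ y∈ | j , A , B , j< , A∈ , B∈ , refl | inj₂ (here refl) = ℕ.n<1+n n
avoiders′-bound (suc fuel) (suc n) α∈ y∈ | j , A , B , j< , A∈ , B∈ , refl | inj₂ (there y∈B) =
  ℕ.m<n⇒m<1+n (ℕ.<-≤-trans (avoiders′-bound fuel (n ∸ j) B∈ y∈B) (ℕ.m∸n≤m n j))

glue-maxDecomposition : ∀ {n j A B} → j < suc n → (∀ {a} → a ∈ A → a < j) → (∀ {b} → b ∈ B → b < n ∸ j) →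
  MaxDecomposition (map (n ∸ j +_) A) n B
glue-maxDecomposition {n} {j} j< A<j B<n∸j = record
  { left≻right = λ x∈ y∈ → case ∈-map⁻ (n ∸ j +_) x∈ of λ
      { (a , _ , refl) → ℕ.<-≤-trans (B<n∸j y∈) (ℕ.m≤m+n (n ∸ j) a) }
  ; m≻left = λ x∈ → case ∈-map⁻ (n ∸ j +_) x∈ of λ
      { (a , a∈ , refl) → shift-< j< (A<j a∈) }
  ; m≻right = λ y∈ → ℕ.<-≤-trans (B<n∸j y∈) (ℕ.m∸n≤m n j)
  }

glue-injective : ∀ {fuel n j j′ A A′ B B′} → j < suc n → j′ < suc n →
  A ∈ avoiders′ fuel j → A′ ∈ avoiders′ fuel j′ →
  glue n (n ∸ j) A B ≡ glue n (n ∸ j′) A′ B′ → j ≡ j′ × A ≡ A′ × B ≡ B′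
glue-injective {fuel} {n} {j} {j′} {A} {A′} j< j′< A∈ A′∈ e
  with ++-∷-injective (map (n ∸ j +_) A) _ (map (n ∸ j′ +_) A′) _ (n∉ j< A∈) (n∉ j′< A′∈) e
  where
  n∉ : ∀ {j A} → j < suc n → A ∈ avoiders′ fuel j → n ∉ map (n ∸ j +_) A
  n∉ {j} j< A∈ n∈ with ∈-map⁻ (n ∸ j +_) n∈
  ... | a , a∈ , n≡ = ℕ.<-irrefl (sym n≡) (shift-< j< (avoiders′-bound fuel j A∈ a∈))
... | A≡ , refl with trans (sym (avoiders′-length fuel j A∈))
                          (trans (sym (List.length-map (n ∸ j +_) A))
                          (trans (cong length A≡) (trans (List.length-map (n ∸ j′ +_) A′) (avoiders′-length fuel j′ A′∈))))
...   | refl = refl , List.map-injective (ℕ.+-cancelˡ-≡ (n ∸ j) _ _) A≡ , refl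

Unique-avoiders′ : ∀ fuel n → Unique (avoiders′ fuel n)
Unique-avoiders′ fuel zero = [] ∷ []
Unique-avoiders′ zero (suc n) = []
Unique-avoiders′ (suc fuel) (suc n) =
  Unique-concatMap _ (upTo (suc n)) (Unique.upTo⁺ (suc n))
    (λ {j} j∈ → Unique-concatMap _ (avoiders′ fuel j) (Unique-avoiders′ fuel j)
       (λ {A} _ → Unique.map⁺ (List.∷-injectiveʳ ∘ List.++-cancelˡ (map (n ∸ j +_) A) _ _) (Unique-avoiders′ fuel (n ∸ j)))
       (λ A∈ A′∈ α∈ α∈′ → case ∈-map⁻ _ α∈ , ∈-map⁻ _ α∈′ of λ
          { ((_ , _ , e) , (_ , _ , e′)) → proj₁ (proj₂ (glue-injective (∈-upTo⁻ j∈) (∈-upTo⁻ j∈) A∈ A′∈ (trans (sym e) e′))) }))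
    (λ {j} {j′} j∈ j′∈ α∈ α∈′ →
       case ∈-concatMap-find _ (avoiders′ fuel j) α∈ , ∈-concatMap-find _ (avoiders′ fuel j′) α∈′ of λ
       { ((A , A∈ , β∈) , (A′ , A′∈ , β∈′)) → case ∈-map⁻ _ β∈ , ∈-map⁻ _ β∈′ of λ
         { ((_ , _ , e) , (_ , _ , e′)) → proj₁ (glue-injective (∈-upTo⁻ j∈) (∈-upTo⁻ j′∈) A∈ A′∈ (trans (sym e) e′)) } })

Avoider : ℕ → List ℕ → Set
Avoider n α = α ↭ upTo n × ¬ Contains α p132

module _ {A B : List ℕ} {m : ℕ} (d : MaxDecomposition A m B) where
  open SplitAtMaximum d

  glue-avoids-132 : ¬ Contains A p132 → ¬ Contains B p132 → ¬ Contains (A ++ m ∷ B) p132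
  glue-avoids-132 ¬A ¬B c with split⁻ c
  ... | inj₁ (τ₁ , τ₂ , e , τ₁≻τ₂ , cA , cB) = without τ₁ τ₂ e τ₁≻τ₂ cA cB
    where
    without : ∀ τ₁ τ₂ → p132 ≡ τ₁ ++ τ₂ → T (above τ₁ τ₂) → Contains A τ₁ → Contains B τ₂ → ⊥
    without [] _ refl _ _ cB = ¬B cB
    without (_ ∷ []) _ refl () _ _
    without (_ ∷ _ ∷ []) _ refl () _ _
    without (_ ∷ _ ∷ _ ∷ []) [] refl _ cA _ = ¬A cA
  ... | inj₂ (τ₁ , τ₂ , t , e , τ₁≺t , τ₁t≻τ₂ , _ , _) = through τ₁ t τ₂ e τ₁≺t τ₁t≻τ₂
    where
    through : ∀ τ₁ t τ₂ → p132 ≡ τ₁ ++ t ∷ τ₂ → T (below τ₁ (t ∷ [])) → T (above (τ₁ ++ t ∷ []) τ₂) → ⊥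
    through [] _ _ refl _ ()
    through (_ ∷ []) _ _ refl _ ()
    through (_ ∷ _ ∷ []) _ _ refl () _
    through (_ ∷ _ ∷ _ ∷ []) _ _ () _ _
    through (_ ∷ _ ∷ _ ∷ _ ∷ _) _ _ () _ _

upTo-suc : ∀ n → upTo (suc n) ≡ 0 ∷ map suc (upTo n)
upTo-suc n = cong (0 ∷_) (sym (List.map-upTo suc n))

upTo-+ : ∀ k j → upTo (k + j) ≡ upTo k ++ map (k +_) (upTo j)
upTo-+ zero j = sym (List.map-id (upTo j))
upTo-+ (suc k) j = begin
  upTo (suc k + j)                                      ≡⟨ upTo-suc (k + j) ⟩
  0 ∷ map suc (upTo (k + j))                            ≡⟨ cong (λ l → 0 ∷ map suc l) (upTo-+ k j) ⟩
  0 ∷ map suc (upTo k ++ map (k +_) (upTo j))           ≡⟨ cong (0 ∷_) (List.map-++ suc (upTo k) _) ⟩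
  0 ∷ map suc (upTo k) ++ map suc (map (k +_) (upTo j)) ≡⟨ cong (λ l → 0 ∷ map suc (upTo k) ++ l) (sym (List.map-∘ (upTo j))) ⟩
  0 ∷ map suc (upTo k) ++ map (suc k +_) (upTo j)       ≡⟨ cong (_++ map (suc k +_) (upTo j)) (sym (upTo-suc k)) ⟩
  upTo (suc k) ++ map (suc k +_) (upTo j)               ∎
  where open ≡-Reasoning

↭-cancelʳ : ∀ (xs ys zs : List ℕ) → xs ++ zs ↭ ys ++ zs → xs ↭ ys
↭-cancelʳ xs ys [] p = subst₂ _↭_ (List.++-identityʳ xs) (List.++-identityʳ ys) p
↭-cancelʳ xs ys (z ∷ zs) p = ↭-cancelʳ xs ys zs (drop-mid xs ys p)

∈-avoiders′⇒avoider : ∀ fuel n {α} → n ≤ fuel → α ∈ avoiders′ fuel n → Avoider n α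
∈-avoiders′⇒avoider fuel zero _ (here refl) = ↭-refl , λ c → case contains⁻ c of λ { (_ , [] , ()) }
∈-avoiders′⇒avoider (suc fuel) (suc n) (s≤s n≤fuel) α∈ with ∈-avoiders′⁻ {fuel} {n} α∈
... | j , A , B , j< , A∈ , B∈ , refl with ∈-avoiders′⇒avoider fuel j (ℕ.≤-trans (ℕ.≤-pred j<) n≤fuel) A∈
                                        | ∈-avoiders′⇒avoider fuel (n ∸ j) (ℕ.≤-trans (ℕ.m∸n≤m n j) n≤fuel) B∈
...   | A↭ , ¬A | B↭ , ¬B =
  permutation
  , glue-avoids-132 (glue-maxDecomposition j< (avoiders′-bound fuel j A∈) (avoiders′-bound fuel (n ∸ j) B∈))
                    (¬A ∘ contains-shift⁻ k) ¬B
  where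
  k = n ∸ j
  permutation : glue n k A B ↭ upTo (suc n)
  permutation = begin
    map (k +_) A ++ n ∷ B                   ↭⟨ ++⁺ (map⁺ (k +_) A↭) (↭-prep n B↭) ⟩
    map (k +_) (upTo j) ++ n ∷ upTo k       ↭⟨ ↭-shift n (map (k +_) (upTo j)) (upTo k) ⟩
    n ∷ map (k +_) (upTo j) ++ upTo k       ↭⟨ ↭-prep n (++-comm (map (k +_) (upTo j)) (upTo k)) ⟩
    n ∷ upTo k ++ map (k +_) (upTo j)       ↭⟨ ∷↭∷ʳ n (upTo k ++ map (k +_) (upTo j)) ⟩
    (upTo k ++ map (k +_) (upTo j)) ++ n ∷ []
      ≡⟨ cong (_++ n ∷ []) (trans (sym (upTo-+ k j)) (cong upTo (trans (ℕ.+-comm k j) (ℕ.m+[n∸m]≡n (ℕ.≤-pred j<))))) ⟩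
    upTo n ++ n ∷ []                        ≡⟨ List.upTo-∷ʳ n ⟩
    upTo (suc n)                            ∎
    where open PermutationReasoning

Unique-resp-↭ : ∀ {xs ys : List ℕ} → xs ↭ ys → Unique xs → Unique ys
Unique-resp-↭ p = PermutationSetoid.Unique-resp-↭ (setoid ℕ) (↭⇒↭ₛ p)

-- Remove the largest value n - 1, which lies in A, and recurse.
lower-part : ∀ n (A B : List ℕ) → A ++ B ↭ upTo n → A ≻ B → B ↭ upTo (length B)
lower-part zero A B p _ with List.++-conicalʳ A B (↭-empty-inv p)
... | refl = ↭-refl
lower-part (suc n) A B p A≻B with ∈-++⁻ A (∈-resp-↭ (↭-sym p) (∈-upTo⁺ (ℕ.n<1+n n)))
... | inj₂ n∈B with A
...   | [] = subst (λ l → B ↭ upTo l) (sym (trans (↭-length p) (List.length-upTo (suc n)))) p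
...   | a ∷ _ = ⊥-elim (ℕ.<⇒≱ (A≻B (here refl) n∈B) (ℕ.≤-pred (∈-upTo⁻ (∈-resp-↭ p (here refl)))))
lower-part (suc n) A B p A≻B | inj₁ n∈A with ∈-∃++ n∈A
... | A₁ , A₂ , refl = lower-part n (A₁ ++ A₂) B p′ (λ a∈ → A≻B (widen a∈))
  where
  p′ : (A₁ ++ A₂) ++ B ↭ upTo n
  p′ = subst (_↭ upTo n) (sym (List.++-assoc A₁ A₂ B))
         (subst (A₁ ++ A₂ ++ B ↭_) (List.++-identityʳ (upTo n))
           (drop-mid A₁ (upTo n) (subst₂ _↭_ (List.++-assoc A₁ (n ∷ A₂) B) (sym (List.upTo-∷ʳ n)) p)))
  widen : ∀ {a} → a ∈ A₁ ++ A₂ → a ∈ A₁ ++ n ∷ A₂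
  widen a∈ with ∈-++⁻ A₁ a∈
  ... | inj₁ a∈A₁ = ∈-++⁺ˡ a∈A₁
  ... | inj₂ a∈A₂ = ∈-++⁺ʳ A₁ (there a∈A₂)

132-occurrence : ∀ {a n b} → a < b → b < n → T (orderIso p132 (a ∷ n ∷ b ∷ []))
132-occurrence {a} {n} {b} a<b b<n
  rewrite T⇒≡true (ℕ.<⇒<ᵇ (ℕ.<-trans a<b b<n)) | <ᵇ-asym {a} {n} (ℕ.<⇒<ᵇ (ℕ.<-trans a<b b<n))
        | T⇒≡true (ℕ.<⇒<ᵇ a<b) | <ᵇ-asym {a} {b} (ℕ.<⇒<ᵇ a<b)
        | T⇒≡true (ℕ.<⇒<ᵇ b<n) | <ᵇ-asym {b} {n} (ℕ.<⇒<ᵇ b<n) = _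

∈⇒[]⊆ : ∀ {x : ℕ} {xs} → x ∈ xs → (x ∷ []) ⊆ xs
∈⇒[]⊆ {xs = _ ∷ xs} (here refl) = refl ∷ minimum xs
∈⇒[]⊆ {xs = y ∷ _} (there x∈) = y ∷ʳ ∈⇒[]⊆ x∈

Unique-++-disjoint : ∀ (A B : List ℕ) {x} → Unique (A ++ B) → x ∈ A → x ∉ B
Unique-++-disjoint (a ∷ A) B (a∉ ∷ _) (here refl) x∈B = All.lookup a∉ (∈-++⁺ʳ A x∈B) refl
Unique-++-disjoint (a ∷ A) B (_ ∷ u) (there x∈A) x∈B = Unique-++-disjoint A B u x∈A x∈B

avoider-maxDecomposition : ∀ {n} A B → Avoider (suc n) (A ++ n ∷ B) → MaxDecomposition A n B
avoider-maxDecomposition {n} A B (p , ¬132) = record { left≻right = A≻B ; m≻left = n≻A ; m≻right = n≻B }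
  where
  unique : Unique (A ++ n ∷ B)
  unique = Unique-resp-↭ (↭-sym p) (Unique.upTo⁺ (suc n))
  ≤n : ∀ {y} → y ∈ A ++ n ∷ B → y ≤ n
  ≤n y∈ = ℕ.≤-pred (∈-upTo⁻ (∈-resp-↭ p y∈))
  n≻A : ∀ {a} → a ∈ A → a < n
  n≻A a∈ = ℕ.≤∧≢⇒< (≤n (∈-++⁺ˡ a∈)) λ { refl → Unique-++-disjoint A (n ∷ B) unique a∈ (here refl) }
  n≻B : ∀ {b} → b ∈ B → b < n
  n≻B b∈ = ℕ.≤∧≢⇒< (≤n (∈-++⁺ʳ A (there b∈)))
             λ { refl → Unique.Unique[x∷xs]⇒x∉xs (subst Unique (drop-++-length A (n ∷ B)) (Unique.drop⁺ (length A) unique)) b∈ }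
  A≻B : A ≻ B
  A≻B {a} {b} a∈ b∈ with ℕ.<-cmp a b
  ... | tri< a<b _ _ = ⊥-elim (¬132 (contains⁺ (⊆-++⁺ (∈⇒[]⊆ a∈) (refl ∷ ∈⇒[]⊆ b∈)) (132-occurrence a<b (n≻B b∈))))
  ... | tri≈ _ refl _ = ⊥-elim (Unique-++-disjoint A (n ∷ B) unique a∈ (there b∈))
  ... | tri> _ _ b<a = b<a

avoider-glue : ∀ {n α} → Avoider (suc n) α →
  ∃ λ j → ∃₂ λ A B → j < suc n × Avoider j A × Avoider (n ∸ j) B × α ≡ glue n (n ∸ j) A B
avoider-glue {n} (p , ¬132) with ∈-∃++ (∈-resp-↭ (↭-sym p) (∈-upTo⁺ (ℕ.n<1+n n)))
... | A′ , B , refl = unshift (↭-map-inv (k +_) (↭-sym upper))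
  where
  k = length B
  j = length A′
  α = A′ ++ n ∷ B
  rest : A′ ++ B ↭ upTo n
  rest = subst (A′ ++ B ↭_) (List.++-identityʳ (upTo n))
           (drop-mid A′ (upTo n) (subst (α ↭_) (sym (List.upTo-∷ʳ n)) p))
  lower : B ↭ upTo k
  lower = lower-part n A′ B rest (MaxDecomposition.left≻right (avoider-maxDecomposition A′ B (p , ¬132)))
  n≡k+j : n ≡ k + j
  n≡k+j = trans (sym (List.length-upTo n)) (trans (sym (↭-length rest)) (trans (List.length-++ A′) (ℕ.+-comm j k)))
  n∸j≡k : n ∸ j ≡ k
  n∸j≡k = trans (cong (_∸ j) n≡k+j) (ℕ.m+n∸n≡m k j)
  upper : A′ ↭ map (k +_) (upTo j)
  upper = ↭-cancelʳ A′ (map (k +_) (upTo j)) (upTo k) (begin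
    A′ ++ upTo k                    ↭⟨ ++⁺ˡ A′ (↭-sym lower) ⟩
    A′ ++ B                         ↭⟨ rest ⟩
    upTo n                          ≡⟨ trans (cong upTo n≡k+j) (upTo-+ k j) ⟩
    upTo k ++ map (k +_) (upTo j)   ↭⟨ ++-comm (upTo k) (map (k +_) (upTo j)) ⟩
    map (k +_) (upTo j) ++ upTo k   ∎)
    where open PermutationReasoning
  ¬B : ¬ Contains B p132
  ¬B c = ¬132 (contains-⊆ (⊆-++⁺ (minimum A′) (n ∷ʳ ⊆-refl)) c)
  unshift : (∃ λ A → A′ ≡ map (k +_) A × upTo j ↭ A) →
    ∃ λ j → ∃₂ λ A B → j < suc n × Avoider j A × Avoider (n ∸ j) B × α ≡ glue n (n ∸ j) A B
  unshift (A , A′≡ , A↭) =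
    j , A , B , s≤s (subst (j ≤_) (sym n≡k+j) (ℕ.m≤n+m j k)) , (↭-sym A↭ , ¬A)
    , (subst (λ k → B ↭ upTo k) (sym n∸j≡k) lower , ¬B)
    , trans (cong (_++ n ∷ B) A′≡) (cong (λ k → map (k +_) A ++ n ∷ B) (sym n∸j≡k))
    where
    ¬A : ¬ Contains A p132
    ¬A c = ¬132 (contains-⊆ (subst (_⊆ α) (List.++-identityʳ A′) (⊆-++⁺ ⊆-refl (minimum (n ∷ B))))
                             (subst (λ A′ → Contains A′ p132) (sym A′≡) (contains-shift⁺ k c)))

avoider⇒∈-avoiders′ : ∀ fuel n {α} → n ≤ fuel → Avoider n α → α ∈ avoiders′ fuel n
avoider⇒∈-avoiders′ fuel zero _ (p , _) with ↭-empty-inv p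
... | refl = here refl
avoider⇒∈-avoiders′ (suc fuel) (suc n) (s≤s n≤fuel) a with avoider-glue a
... | j , A , B , j< , avA , avB , refl =
  ∈-avoiders′⁺ j< (avoider⇒∈-avoiders′ fuel j (ℕ.≤-trans (ℕ.≤-pred j<) n≤fuel) avA)
                  (avoider⇒∈-avoiders′ fuel (n ∸ j) (ℕ.≤-trans (ℕ.m∸n≤m n j) n≤fuel) avB)

-- Counting 132-avoiders

𝟙 : Bool → ℤ
𝟙 true = 1ℤ
𝟙 false = 0ℤ

sumOver : ∀ {A : Set} → List A → (A → ℤ) → ℤ
sumOver [] w = 0ℤ
sumOver (x ∷ xs) w = w x +ℤ sumOver xs w

syntax sumOver xs (λ x → e) = Σ[ x ∈ xs ] e

module _ {A : Set} where

  sumOver-↭ : ∀ {xs ys : List A} (w : A → ℤ) → xs ↭ ys → sumOver xs w ≡ sumOver ys w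
  sumOver-↭ w ↭-refl = refl
  sumOver-↭ w (↭-prep x p) = cong (w x +ℤ_) (sumOver-↭ w p)
  sumOver-↭ {x ∷ y ∷ _} {_ ∷ _ ∷ ys} w (↭-swap x y p) =
    trans (cong (λ s → w x +ℤ (w y +ℤ s)) (sumOver-↭ w p)) (lemma (w x) (w y) (sumOver ys w))
    where
    lemma : ∀ a b c → a +ℤ (b +ℤ c) ≡ b +ℤ (a +ℤ c)
    lemma = solve-∀
  sumOver-↭ w (↭-trans p q) = trans (sumOver-↭ w p) (sumOver-↭ w q)

  sumOver-++ : ∀ (xs ys : List A) w → sumOver (xs ++ ys) w ≡ sumOver xs w +ℤ sumOver ys w
  sumOver-++ [] ys w = sym (ℤ.+-identityˡ (sumOver ys w))
  sumOver-++ (x ∷ xs) ys w =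
    trans (cong (w x +ℤ_) (sumOver-++ xs ys w)) (sym (ℤ.+-assoc (w x) (sumOver xs w) (sumOver ys w)))

  sumOver-cong : ∀ (xs : List A) {w w′} → (∀ {x} → x ∈ xs → w x ≡ w′ x) → sumOver xs w ≡ sumOver xs w′
  sumOver-cong [] _ = refl
  sumOver-cong (x ∷ xs) w≡ = cong₂ _+ℤ_ (w≡ (here refl)) (sumOver-cong xs (w≡ ∘ there))

  sumOver-+ : ∀ (xs : List A) u v → (Σ[ x ∈ xs ] (u x +ℤ v x)) ≡ sumOver xs u +ℤ sumOver xs v
  sumOver-+ [] u v = refl
  sumOver-+ (x ∷ xs) u v =
    trans (cong (u x +ℤ v x +ℤ_) (sumOver-+ xs u v)) (lemma (u x) (v x) (sumOver xs u) (sumOver xs v))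
    where
    lemma : ∀ a b c d → (a +ℤ b) +ℤ (c +ℤ d) ≡ (a +ℤ c) +ℤ (b +ℤ d)
    lemma = solve-∀

  sumOver-neg : ∀ (xs : List A) u → (Σ[ x ∈ xs ] (- u x)) ≡ - sumOver xs u
  sumOver-neg [] u = refl
  sumOver-neg (x ∷ xs) u = trans (cong (- u x +ℤ_) (sumOver-neg xs u)) (sym (ℤ.neg-distrib-+ (u x) (sumOver xs u)))

  sumOver-*ˡ : ∀ (xs : List A) c u → (Σ[ x ∈ xs ] (c *ℤ u x)) ≡ c *ℤ sumOver xs u
  sumOver-*ˡ [] c u = sym (ℤ.*-zeroʳ c)
  sumOver-*ˡ (x ∷ xs) c u = trans (cong (c *ℤ u x +ℤ_) (sumOver-*ˡ xs c u)) (sym (ℤ.*-distribˡ-+ c (u x) (sumOver xs u)))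

  length-filter : ∀ (p : A → Bool) xs → ℤ.+ length (filter (T? ∘ p) xs) ≡ (Σ[ x ∈ xs ] 𝟙 (p x))
  length-filter p [] = refl
  length-filter p (x ∷ xs) with p x
  ... | true = trans (ℤ.pos-+ 1 (length (filter (T? ∘ p) xs))) (cong (1ℤ +ℤ_) (length-filter p xs))
  ... | false = trans (length-filter p xs) (sym (ℤ.+-identityˡ _))

sumOver-map : ∀ {A B : Set} (g : A → B) xs (w : B → ℤ) → sumOver (map g xs) w ≡ (Σ[ x ∈ xs ] w (g x))
sumOver-map g [] w = refl
sumOver-map g (x ∷ xs) w = cong (w (g x) +ℤ_) (sumOver-map g xs w)

sumOver-concatMap : ∀ {A B : Set} (g : A → List B) xs (w : B → ℤ) → sumOver (concatMap g xs) w ≡ (Σ[ x ∈ xs ] sumOver (g x) w)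
sumOver-concatMap g [] w = refl
sumOver-concatMap g (x ∷ xs) w =
  trans (sumOver-++ (g x) (concatMap g xs) w) (cong (sumOver (g x) w +ℤ_) (sumOver-concatMap g xs w))

sumOver-product : ∀ {A B : Set} (xs : List A) (ys : List B) u v →
  (Σ[ x ∈ xs ] Σ[ y ∈ ys ] (u x *ℤ v y)) ≡ sumOver xs u *ℤ sumOver ys v
sumOver-product xs ys u v =
  trans (sumOver-cong xs (λ {x} _ → trans (sumOver-*ˡ ys (u x) v) (ℤ.*-comm (u x) (sumOver ys v))))
        (trans (sumOver-*ˡ xs (sumOver ys v) u) (ℤ.*-comm (sumOver ys v) (sumOver xs u)))

sumOver-upTo-*ₛ : ∀ (a b : Series) n → (Σ[ j ∈ upTo (suc n) ] (a j *ℤ b (n ∸ j))) ≡ (a *ₛ b) n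
sumOver-upTo-*ₛ a b zero = ℤ.+-identityʳ (a 0 *ℤ b 0)
sumOver-upTo-*ₛ a b (suc n) =
  trans (cong (λ js → Σ[ j ∈ js ] (a j *ℤ b (suc n ∸ j))) (upTo-suc (suc n)))
        (cong (a 0 *ℤ b (suc n) +ℤ_) (trans (sumOver-map suc (upTo (suc n)) (λ j → a j *ℤ b (suc n ∸ j)))
                                            (sumOver-upTo-*ₛ (tailₛ a) b n)))

↭-unique : ∀ {A : Set} {xs ys : List A} → Unique xs → Unique ys →
  (∀ {z} → z ∈ xs → z ∈ ys) → (∀ {z} → z ∈ ys → z ∈ xs) → xs ↭ ys
↭-unique u v to from = ∼bag⇒↭ (unique∧set⇒bag u v (mk⇔ to from))

avoiders′↭avoiders : ∀ fuel j → j ≤ fuel → avoiders′ fuel j ↭ avoiders j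
avoiders′↭avoiders fuel j j≤fuel = ↭-unique (Unique-avoiders′ fuel j) (Unique-avoiders′ j j)
  (avoider⇒∈-avoiders′ j j ℕ.≤-refl ∘ ∈-avoiders′⇒avoider fuel j j≤fuel)
  (avoider⇒∈-avoiders′ fuel j j≤fuel ∘ ∈-avoiders′⇒avoider j j ℕ.≤-refl)

weight : (List ℕ → ℤ) → Series
weight u j = Σ[ α ∈ avoiders j ] u α

avoidance : List ℕ → List ℕ → ℤ
avoidance τ α = 𝟙 (not (contains α τ))

count : List ℕ → Series
count τ = weight (avoidance τ)

glueSum : (ℕ → List ℕ → List ℕ → ℤ) → ℕ → ℤ
glueSum Φ n = Σ[ j ∈ upTo (suc n) ] Σ[ A ∈ avoiders j ] Σ[ B ∈ avoiders (n ∸ j) ] Φ j A B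

count-suc : ∀ τ n → count τ (suc n) ≡ glueSum (λ j A B → avoidance τ (glue n (n ∸ j) A B)) n
count-suc τ n =
  trans (sumOver-concatMap (λ j → concatMap (λ A → map (glue n (n ∸ j) A) (avoiders′ n (n ∸ j))) (avoiders′ n j))
                           (upTo (suc n)) (avoidance τ))
  (sumOver-cong (upTo (suc n)) λ {j} j∈ → begin
    sumOver (concatMap (λ A → map (glue n (n ∸ j) A) (avoiders′ n (n ∸ j))) (avoiders′ n j)) (avoidance τ)
      ≡⟨ sumOver-concatMap (λ A → map (glue n (n ∸ j) A) (avoiders′ n (n ∸ j))) (avoiders′ n j) (avoidance τ) ⟩
    (Σ[ A ∈ avoiders′ n j ] sumOver (map (glue n (n ∸ j) A) (avoiders′ n (n ∸ j))) (avoidance τ))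
      ≡⟨ sumOver-↭ (λ A → sumOver (map (glue n (n ∸ j) A) (avoiders′ n (n ∸ j))) (avoidance τ))
                   (avoiders′↭avoiders n j (ℕ.≤-pred (∈-upTo⁻ j∈))) ⟩
    (Σ[ A ∈ avoiders j ] sumOver (map (glue n (n ∸ j) A) (avoiders′ n (n ∸ j))) (avoidance τ))
      ≡⟨ sumOver-cong (avoiders j) (λ {A} _ →
           trans (sumOver-map (glue n (n ∸ j) A) (avoiders′ n (n ∸ j)) (avoidance τ))
                 (sumOver-↭ (λ B → avoidance τ (glue n (n ∸ j) A B)) (avoiders′↭avoiders n (n ∸ j) (ℕ.m∸n≤m n j)))) ⟩
    (Σ[ A ∈ avoiders j ] Σ[ B ∈ avoiders (n ∸ j) ] avoidance τ (glue n (n ∸ j) A B)) ∎)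
  where open ≡-Reasoning

module _ (n : ℕ) where

  glueSum-cong : ∀ {Φ Ψ} → (∀ {j A B} → j < suc n → A ∈ avoiders j → B ∈ avoiders (n ∸ j) → Φ j A B ≡ Ψ j A B) →
    glueSum Φ n ≡ glueSum Ψ n
  glueSum-cong Φ≡Ψ =
    sumOver-cong (upTo (suc n)) λ j∈ → sumOver-cong _ λ A∈ → sumOver-cong _ λ B∈ → Φ≡Ψ (∈-upTo⁻ j∈) A∈ B∈

  glueSum-+ : ∀ Φ Ψ → glueSum (λ j A B → Φ j A B +ℤ Ψ j A B) n ≡ glueSum Φ n +ℤ glueSum Ψ n
  glueSum-+ Φ Ψ =
    trans (sumOver-cong (upTo (suc n)) λ {j} _ →
             trans (sumOver-cong (avoiders j) λ {A} _ → sumOver-+ (avoiders (n ∸ j)) (Φ j A) (Ψ j A))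
                   (sumOver-+ (avoiders j) (λ A → sumOver (avoiders (n ∸ j)) (Φ j A))
                                           (λ A → sumOver (avoiders (n ∸ j)) (Ψ j A))))
          (sumOver-+ (upTo (suc n)) (λ j → Σ[ A ∈ avoiders j ] sumOver (avoiders (n ∸ j)) (Φ j A))
                                    (λ j → Σ[ A ∈ avoiders j ] sumOver (avoiders (n ∸ j)) (Ψ j A)))

  glueSum-product : ∀ u v → glueSum (λ _ A B → u A *ℤ v B) n ≡ (weight u *ₛ weight v) n
  glueSum-product u v = trans (sumOver-cong (upTo (suc n)) λ {j} _ → sumOver-product (avoiders j) (avoiders (n ∸ j)) u v)
                                (sumOver-upTo-*ₛ (weight u) (weight v) n)

T-not⇒¬T : ∀ {b} → T (not b) → ¬ T b
T-not⇒¬T {false} _ ()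

¬T⇒T-not : ∀ {b} → ¬ T b → T (not b)
¬T⇒T-not {false} _ = _
¬T⇒T-not {true} ¬b = ¬b _

f≡count : ∀ τ n → ℤ.+ f τ n ≡ count τ n
f≡count τ n = trans (cong ℤ.+_ (↭-length same)) (length-filter (λ α → not (contains α τ)) (avoiders n))
  where
  P? = T? ∘ avoids132and τ
  Q? = T? ∘ (λ α → not (contains α τ))
  same : filter P? (Sym n) ↭ filter Q? (avoiders n)
  same = ↭-unique (Unique.filter⁺ P? (Unique-Sym n)) (Unique.filter⁺ Q? (Unique-avoiders′ n n)) to from
    where
    to : ∀ {α} → α ∈ filter P? (Sym n) → α ∈ filter Q? (avoiders n)
    to {α} α∈ with ∈-filter⁻ P? {xs = Sym n} α∈
    ... | α∈Sym , avoids with Equivalence.to T-∧ avoids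
    ...   | ¬132 , ¬τ =
      ∈-filter⁺ Q? (avoider⇒∈-avoiders′ n n ℕ.≤-refl (∈-perms⁻ (upTo n) α∈Sym , T-not⇒¬T ¬132 ∘ Contains.holds)) ¬τ
    from : ∀ {α} → α ∈ filter Q? (avoiders n) → α ∈ filter P? (Sym n)
    from {α} α∈ with ∈-filter⁻ Q? {xs = avoiders n} α∈
    ... | α∈avoiders , ¬τ with ∈-avoiders′⇒avoider n n ℕ.≤-refl α∈avoiders
    ...   | α↭ , ¬132 = ∈-filter⁺ P? (∈-perms⁺ (upTo n) α↭) (Equivalence.from T-∧ (¬T⇒T-not (¬132 ∘ mkContains) , ¬τ))

T⇒≤ : ∀ {x y} → (T x → T y) → x ≤ᵇ y
T⇒≤ {false} {false} _ = b≤b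
T⇒≤ {false} {true} _ = f≤t
T⇒≤ {true} {false} x⇒y = ⊥-elim (x⇒y _)
T⇒≤ {true} {true} _ = b≤b

𝟙-not-∨ : ∀ x y → 𝟙 (not (x ∨ y)) ≡ 𝟙 (not x) *ℤ 𝟙 (not y)
𝟙-not-∨ false false = refl
𝟙-not-∨ false true = refl
𝟙-not-∨ true _ = refl

-- Avoidance splits according to the longest prefix pattern that the left part contains.
𝟙-split₂ : ∀ {a₀ a₁ b₀ b₁} → a₁ ≤ᵇ a₀ → b₁ ≤ᵇ b₀ →
  𝟙 (not ((b₁ ∨ a₁) ∨ (a₀ ∧ b₀)))
    ≡ (𝟙 (not a₀) *ℤ 𝟙 (not b₁) +ℤ 𝟙 (not a₁) *ℤ 𝟙 (not b₀)) +ℤ - 𝟙 (not a₀) *ℤ 𝟙 (not b₀)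
𝟙-split₂ f≤t f≤t = refl
𝟙-split₂ f≤t (b≤b {false}) = refl
𝟙-split₂ f≤t (b≤b {true}) = refl
𝟙-split₂ (b≤b {false}) f≤t = refl
𝟙-split₂ (b≤b {false}) (b≤b {false}) = refl
𝟙-split₂ (b≤b {false}) (b≤b {true}) = refl
𝟙-split₂ (b≤b {true}) f≤t = refl
𝟙-split₂ (b≤b {true}) (b≤b {false}) = refl
𝟙-split₂ (b≤b {true}) (b≤b {true}) = refl

𝟙-split₃ : ∀ {a₀ a₁ a₂ b₀ b₁ b₂} → a₂ ≤ᵇ a₁ → a₁ ≤ᵇ a₀ → b₂ ≤ᵇ b₁ → b₁ ≤ᵇ b₀ →
  𝟙 (not ((b₂ ∨ a₂) ∨ ((a₁ ∧ b₀) ∨ (a₀ ∧ b₁))))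
    ≡ (𝟙 (not a₀) *ℤ 𝟙 (not b₂) +ℤ (𝟙 (not a₁) +ℤ - 𝟙 (not a₀)) *ℤ 𝟙 (not b₁))
      +ℤ (𝟙 (not a₂) +ℤ - 𝟙 (not a₁)) *ℤ 𝟙 (not b₀)
𝟙-split₃ (b≤b {false}) (b≤b {false}) (b≤b {false}) (b≤b {false}) = refl
𝟙-split₃ (b≤b {false}) (b≤b {false}) (b≤b {false}) f≤t = refl
𝟙-split₃ (b≤b {false}) (b≤b {false}) f≤t (b≤b {true}) = refl
𝟙-split₃ (b≤b {false}) (b≤b {false}) (b≤b {true}) (b≤b {true}) = refl
𝟙-split₃ (b≤b {false}) f≤t (b≤b {false}) (b≤b {false}) = refl
𝟙-split₃ (b≤b {false}) f≤t (b≤b {false}) f≤t = refl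
𝟙-split₃ (b≤b {false}) f≤t f≤t (b≤b {true}) = refl
𝟙-split₃ (b≤b {false}) f≤t (b≤b {true}) (b≤b {true}) = refl
𝟙-split₃ f≤t (b≤b {true}) (b≤b {false}) (b≤b {false}) = refl
𝟙-split₃ f≤t (b≤b {true}) (b≤b {false}) f≤t = refl
𝟙-split₃ f≤t (b≤b {true}) f≤t (b≤b {true}) = refl
𝟙-split₃ f≤t (b≤b {true}) (b≤b {true}) (b≤b {true}) = refl
𝟙-split₃ (b≤b {true}) (b≤b {true}) (b≤b {false}) (b≤b {false}) = refl
𝟙-split₃ (b≤b {true}) (b≤b {true}) (b≤b {false}) f≤t = refl
𝟙-split₃ (b≤b {true}) (b≤b {true}) f≤t (b≤b {true}) = refl
𝟙-split₃ (b≤b {true}) (b≤b {true}) (b≤b {true}) (b≤b {true}) = refl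

sumOver-zero : ∀ {A : Set} (xs : List A) → (Σ[ x ∈ xs ] 0ℤ) ≡ 0ℤ
sumOver-zero [] = refl
sumOver-zero (x ∷ xs) = trans (ℤ.+-identityˡ _) (sumOver-zero xs)

weight-neg : ∀ u → weight (λ α → - u α) ≋ -ₛ weight u
weight-neg u n = trans (sumOver-neg (avoiders n) u) (sym (-ₛ-pointwise (weight u) n))

weight-sub : ∀ u v → weight (λ α → u α +ℤ - v α) ≋ weight u -ₛ weight v
weight-sub u v n = trans (sumOver-+ (avoiders n) u (λ α → - v α))
                     (trans (cong (weight u n +ℤ_) (weight-neg v n)) (sym (+ₛ-pointwise (weight u) (-ₛ weight v) n)))

module _ (n : ℕ) where

  glueSum-products₃ : ∀ u₁ v₁ u₂ v₂ u₃ v₃ →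
    glueSum (λ _ A B → (u₁ A *ℤ v₁ B +ℤ u₂ A *ℤ v₂ B) +ℤ u₃ A *ℤ v₃ B) n
      ≡ (weight u₁ *ₛ weight v₁ +ₛ weight u₂ *ₛ weight v₂ +ₛ weight u₃ *ₛ weight v₃) n
  glueSum-products₃ u₁ v₁ u₂ v₂ u₃ v₃ = begin
    glueSum (λ _ A B → (u₁ A *ℤ v₁ B +ℤ u₂ A *ℤ v₂ B) +ℤ u₃ A *ℤ v₃ B) n
      ≡⟨ glueSum-+ n (λ _ A B → u₁ A *ℤ v₁ B +ℤ u₂ A *ℤ v₂ B) (λ _ A B → u₃ A *ℤ v₃ B) ⟩
    glueSum (λ _ A B → u₁ A *ℤ v₁ B +ℤ u₂ A *ℤ v₂ B) n +ℤ glueSum (λ _ A B → u₃ A *ℤ v₃ B) n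
      ≡⟨ cong (_+ℤ _) (glueSum-+ n (λ _ A B → u₁ A *ℤ v₁ B) (λ _ A B → u₂ A *ℤ v₂ B)) ⟩
    (glueSum (λ _ A B → u₁ A *ℤ v₁ B) n +ℤ glueSum (λ _ A B → u₂ A *ℤ v₂ B) n) +ℤ glueSum (λ _ A B → u₃ A *ℤ v₃ B) n
      ≡⟨ cong₂ _+ℤ_ (cong₂ _+ℤ_ (glueSum-product n u₁ v₁) (glueSum-product n u₂ v₂)) (glueSum-product n u₃ v₃) ⟩
    ((weight u₁ *ₛ weight v₁) n +ℤ (weight u₂ *ₛ weight v₂) n) +ℤ (weight u₃ *ₛ weight v₃) n
      ≡⟨ sym (trans (+ₛ-pointwise _ _ n) (cong (_+ℤ _) (+ₛ-pointwise _ _ n))) ⟩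
    (weight u₁ *ₛ weight v₁ +ₛ weight u₂ *ₛ weight v₂ +ₛ weight u₃ *ₛ weight v₃) n ∎
    where open ≡-Reasoning

-- The generating functions

count-equation : ∀ τ {Z} → count τ 0 ≡ 1ℤ → tailₛ (count τ) ≋ Z → count τ ≋ 1ₛ +ₛ X *ₛ Z
count-equation τ h₀ hₛ zero = h₀
count-equation τ {Z} h₀ hₛ (suc n) = trans (hₛ n) (sym (trans (ℤ.+-identityˡ _) (X*ₛ-suc Z n)))

module AtGlue {n i A B} (i< : i < suc n) (A∈ : A ∈ avoiders i) (B∈ : B ∈ avoiders (n ∸ i)) where
  open LayeredAtMaximum (glue-maxDecomposition i< (avoiders′-bound i i A∈) (avoiders′-bound (n ∸ i) (n ∸ i) B∈)) public

  contains-shifted : ∀ τ → contains (map (n ∸ i +_) A) τ ≡ contains A τ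
  contains-shifted τ = T-ext (Contains.holds ∘ contains-shift⁻ (n ∸ i) {A} {τ} ∘ mkContains)
                             (Contains.holds ∘ contains-shift⁺ (n ∸ i) {A} {τ} ∘ mkContains)

F : ℕ → Series
F j = count (increasing j)

F-zero : F 0 ≋ 0ₛ
F-zero n = trans (sumOver-cong (avoiders n) λ {α} _ → cong (𝟙 ∘ not) (T⇒≡true (Contains.holds (contains-[] α))))
                   (sumOver-zero (avoiders n))

F-suc : ∀ j → F (suc j) ≋ 1ₛ +ₛ X *ₛ (F j *ₛ F (suc j))
F-suc j = count-equation (increasing (suc j)) refl λ n →
  trans (count-suc (increasing (suc j)) n)
        (trans (glueSum-cong n factor) (glueSum-product n (avoidance (increasing j)) (avoidance (increasing (suc j)))))
  where
  factor : ∀ {n i A B} → i < suc n → A ∈ avoiders i → B ∈ avoiders (n ∸ i) →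
    avoidance (increasing (suc j)) (glue n (n ∸ i) A B) ≡ avoidance (increasing j) A *ℤ avoidance (increasing (suc j)) B
  factor {A = A} {B} i< A∈ B∈ =
    trans (cong (𝟙 ∘ not) (trans (contains-increasing j)
                                 (cong (_∨ contains B (increasing (suc j))) (contains-shifted (increasing j)))))
          (𝟙-not-∨ (contains A (increasing j)) (contains B (increasing (suc j))))
    where open AtGlue i< A∈ B∈

G : ℕ → ℕ → Series
G a b = count (layered (suc a ∷ b ∷ []))

G-equation : ∀ a b → G a b ≋ 1ₛ +ₛ X *ₛ (F a *ₛ G a b +ₛ G a b *ₛ F b -ₛ F a *ₛ F b)
G-equation a b = count-equation τ refl (≋-trans products rearrange)
  where
  τ = layered (suc a ∷ b ∷ [])
  u₃ = λ A → - avoidance (increasing a) A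
  split : ∀ {n i A B} → i < suc n → A ∈ avoiders i → B ∈ avoiders (n ∸ i) →
    avoidance τ (glue n (n ∸ i) A B)
      ≡ (avoidance (increasing a) A *ℤ avoidance τ B +ℤ avoidance τ A *ℤ avoidance (increasing b) B)
        +ℤ u₃ A *ℤ avoidance (increasing b) B
  split {A = A} {B} i< A∈ B∈ =
    trans (cong (𝟙 ∘ not) (trans (contains-layered₂ a b)
              (cong₂ (λ x y → (contains B τ ∨ x) ∨ (y ∧ contains B (increasing b)))
                     (contains-shifted τ) (contains-shifted (increasing a)))))
            (𝟙-split₂ (T⇒≤ (Contains.holds ∘ prefix ∘ mkContains)) (T⇒≤ (Contains.holds ∘ suffix ∘ mkContains)))
    where
    open AtGlue i< A∈ B∈
    prefix : Contains A τ → Contains A (increasing a)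
    prefix = contains-increasing-pred a ∘ subst (Contains A) layered-[ suc a ] ∘ contains-layered-take 1 (suc a ∷ b ∷ [])
    suffix : Contains B τ → Contains B (increasing b)
    suffix = subst (Contains B) layered-[ b ] ∘ contains-layered-drop 1 (suc a ∷ b ∷ [])
  products : tailₛ (G a b) ≋ F a *ₛ G a b +ₛ G a b *ₛ F b +ₛ weight u₃ *ₛ F b
  products n = trans (count-suc τ n) (trans (glueSum-cong n split)
                 (glueSum-products₃ n (avoidance (increasing a)) (avoidance τ) (avoidance τ) (avoidance (increasing b))
                                      u₃ (avoidance (increasing b))))
  rearrange : F a *ₛ G a b +ₛ G a b *ₛ F b +ₛ weight u₃ *ₛ F b ≋ F a *ₛ G a b +ₛ G a b *ₛ F b -ₛ F a *ₛ F b
  rearrange = +-cong ≋-refl (≋-trans (*-cong (weight-neg (avoidance (increasing a))) ≋-refl)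
                                     (solve 2 (λ x y → :- x :* y := :- (x :* y)) ≋-refl (F a) (F b)))

H : ℕ → ℕ → ℕ → Series
H a b g = count (layered (suc a ∷ b ∷ g ∷ []))

H-equation : ∀ a b g →
  H a b g ≋ 1ₛ +ₛ X *ₛ (F a *ₛ H a b g +ₛ (G a b -ₛ F a) *ₛ count (layered (b ∷ g ∷ [])) +ₛ (H a b g -ₛ G a b) *ₛ F g)
H-equation a b g = count-equation τ refl (≋-trans products rearrange)
  where
  τ = layered (suc a ∷ b ∷ g ∷ [])
  τ₂ = layered (suc a ∷ b ∷ [])
  σ = layered (b ∷ g ∷ [])
  u₂ = λ A → avoidance τ₂ A +ℤ - avoidance (increasing a) A
  u₃ = λ A → avoidance τ A +ℤ - avoidance τ₂ A
  split : ∀ {n i A B} → i < suc n → A ∈ avoiders i → B ∈ avoiders (n ∸ i) →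
    avoidance τ (glue n (n ∸ i) A B)
      ≡ (avoidance (increasing a) A *ℤ avoidance τ B +ℤ u₂ A *ℤ avoidance σ B) +ℤ u₃ A *ℤ avoidance (increasing g) B
  split {A = A} {B} i< A∈ B∈ =
    trans (cong (𝟙 ∘ not) (trans (contains-layered₃ a b g)
              (cong₂ (λ x yz → (contains B τ ∨ x) ∨ yz) (contains-shifted τ)
                     (cong₂ (λ y z → (y ∧ contains B (increasing g)) ∨ (z ∧ contains B σ))
                            (contains-shifted τ₂) (contains-shifted (increasing a))))))
            (𝟙-split₃ (T⇒≤ (Contains.holds ∘ contains-layered-take {A} 2 (suc a ∷ b ∷ g ∷ []) ∘ mkContains))
                      (T⇒≤ (Contains.holds ∘ prefix ∘ mkContains))
                      (T⇒≤ (Contains.holds ∘ contains-layered-drop {B} 1 (suc a ∷ b ∷ g ∷ []) ∘ mkContains))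
                      (T⇒≤ (Contains.holds ∘ suffix ∘ mkContains)))
    where
    open AtGlue i< A∈ B∈
    prefix : Contains A τ₂ → Contains A (increasing a)
    prefix = contains-increasing-pred a ∘ subst (Contains A) layered-[ suc a ] ∘ contains-layered-take 1 (suc a ∷ b ∷ [])
    suffix : Contains B σ → Contains B (increasing g)
    suffix = subst (Contains B) layered-[ g ] ∘ contains-layered-drop 1 (b ∷ g ∷ [])
  products : tailₛ (H a b g) ≋ F a *ₛ H a b g +ₛ weight u₂ *ₛ count σ +ₛ weight u₃ *ₛ F g
  products n = trans (count-suc τ n) (trans (glueSum-cong n split)
                 (glueSum-products₃ n (avoidance (increasing a)) (avoidance τ) u₂ (avoidance σ) u₃ (avoidance (increasing g))))
  rearrange : F a *ₛ H a b g +ₛ weight u₂ *ₛ count σ +ₛ weight u₃ *ₛ F g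
            ≋ F a *ₛ H a b g +ₛ (G a b -ₛ F a) *ₛ count σ +ₛ (H a b g -ₛ G a b) *ₛ F g
  rearrange = +-cong (+-cong ≋-refl (*-cong (weight-sub (avoidance τ₂) (avoidance (increasing a))) ≋-refl))
                     (*-cong (weight-sub (avoidance τ) (avoidance τ₂)) ≋-refl)

range≡run : ∀ a c → map (λ i → suc (a + i)) (upTo c) ≡ run a c
range≡run a zero = refl
range≡run a (suc c) = trans (cong (map (λ i → suc (a + i))) (upTo-suc c))
  (cong₂ _∷_ (cong suc (ℕ.+-identityʳ a))
     (trans (sym (List.map-∘ (upTo c)))
            (trans (List.map-cong (λ i → cong suc (ℕ.+-suc a i)) (upTo c)) (range≡run (suc a) c))))

pat≡layered : ∀ k m₁ m₂ → m₂ ≤ m₁ → pat k m₁ m₂ ≡ layered (k ∸ m₁ ∷ m₁ ∸ m₂ ∷ m₂ ∷ [])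
pat≡layered k m₁ m₂ m₂≤m₁ =
  cong₂ _++_ (trans (range≡run m₁ (k ∸ m₁)) (cong (λ S → run S (k ∸ m₁)) (sym m₁≡)))
    (cong₂ _++_ (trans (range≡run m₂ (m₁ ∸ m₂)) (cong (λ S → run S (m₁ ∸ m₂)) (sym (ℕ.+-identityʳ m₂))))
                (trans (range≡run 0 m₂) (sym (List.++-identityʳ (run 0 m₂)))))
  where
  m₁≡ : m₁ ∸ m₂ + (m₂ + 0) ≡ m₁
  m₁≡ = trans (cong (m₁ ∸ m₂ +_) (ℕ.+-identityʳ m₂)) (ℕ.m∸n+n≡m m₂≤m₁)

F-isChebQuotient : ∀ j → IsChebQuotient j (F j)
F-isChebQuotient = F-equations⇒isChebQuotient F-zero F-suc

G-isChebQuotient : ∀ a b → IsChebQuotient (suc (a + b)) (G a b)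
G-isChebQuotient a b = G-equation⇒isChebQuotient {a} {b} (F-isChebQuotient a) (F-isChebQuotient b) (G-equation a b)

layered-generating-function : ∀ α β γ → 0 < α → 0 < β → 0 < γ →
    let Den = R (α + β) ⊗ (R (α + γ) ⊗ R (β + γ))
        Num = (R (α + β) ⊗ (R (α + γ ∸ 1) ⊗ R (β + γ))) ⊕ shift (α + γ) (R (β ∸ 1) ⊗ R β)
    in (n : ℕ) → conv (λ i → ℤ.+ f (layered (α ∷ β ∷ γ ∷ [])) i) (coeff Den) n ≡ coeff Num n
layered-generating-function (suc a) β@(suc b) γ@(suc g) _ _ _ n = begin
  conv (λ i → ℤ.+ f τ i) (coeff Den) n
    ≡⟨ conv≡*ₛ _ (coeff Den) n ⟩
  ((λ i → ℤ.+ f τ i) *ₛ coeff Den) n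
    ≡⟨ *ₛ-cong (f≡count τ) denominator n ⟩
  (H a β γ *ₛ denominatorₛ) n
    ≡⟨ H-equation⇒identity {a} {β} {γ} (F-isChebQuotient a) (F-isChebQuotient γ)
                           (G-isChebQuotient a β) (G-isChebQuotient b γ) (H-equation a β γ) n ⟩
  numeratorₛ n
    ≡⟨ sym (numerator n) ⟩
  coeff Num n ∎
  where
  open ≡-Reasoning
  τ = layered (suc a ∷ β ∷ γ ∷ [])
  Den = R (suc a + β) ⊗ (R (suc a + γ) ⊗ R (β + γ))
  Num = (R (suc a + β) ⊗ (R (suc a + γ ∸ 1) ⊗ R (β + γ))) ⊕ shift (suc a + γ) (R (β ∸ 1) ⊗ R β)
  denominatorₛ = cheb (2 + a + β) *ₛ (cheb (2 + a + γ) *ₛ cheb (suc (β + γ)))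
  numeratorₛ = cheb (2 + a + β) *ₛ (cheb (suc a + γ) *ₛ cheb (suc (β + γ))) +ₛ X^ (suc a + γ) *ₛ (cheb β *ₛ cheb (suc β))
  denominator : coeff Den ≋ denominatorₛ
  denominator = ≋-trans (coeff-⊗ (R (suc a + β)) _) (*-cong ≋-refl (coeff-⊗ (R (suc a + γ)) (R (β + γ))))
  numerator : coeff Num ≋ numeratorₛ
  numerator = ≋-trans (coeff-⊕ (R (suc a + β) ⊗ (R (a + γ) ⊗ R (β + γ))) _)
                      (+-cong (≋-trans (coeff-⊗ (R (suc a + β)) _) (*-cong ≋-refl (coeff-⊗ (R (a + γ)) (R (β + γ)))))
                              (≋-trans (coeff-shift (suc a + γ) _) (*-cong ≋-refl (coeff-⊗ (R b) (R β)))))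

-- Imported only here: in scope earlier, `+_` would make sections such as `(k +_)` ambiguous.
open import Data.Integer using (+_)

theorem2p5 : (k m₁ m₂ : ℕ) → 0 < m₂ → m₂ < m₁ → m₁ < k →
    let α = k ∸ m₁
        β = m₁ ∸ m₂
        γ = m₂
        Den = R (α + β) ⊗ (R (α + γ) ⊗ R (β + γ))
        Num = (R (α + β) ⊗ (R (α + γ ∸ 1) ⊗ R (β + γ)))
              ⊕ shift (α + γ) (R (β ∸ 1) ⊗ R β)
    in (n : ℕ) → conv (λ i → + f (pat k m₁ m₂) i) (coeff Den) n ≡ coeff Num n
theorem2p5 k m₁ m₂ 0<m₂ m₂<m₁ m₁<k rewrite pat≡layered k m₁ m₂ (ℕ.<⇒≤ m₂<m₁) =
  layered-generating-function (k ∸ m₁) (m₁ ∸ m₂) m₂ (ℕ.m<n⇒0<n∸m m₁<k) (ℕ.m<n⇒0<n∸m m₂<m₁) 0<m₂
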